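{- Define $T(n,k)=E(n,n-k)$ for $n\ge1$ and $1\le k\le n$, and $T(n,k)=0$ for $k<1$ or $k>n$. Then $T(n,1)=n!$ for all $n\ge 1$, and for $n\ge 2$, $1\le k\le n$, $$T(n,k)=(n-k+1)\,T(n-1,k-1)+(n-1+k)\,T(n-1,k).$$ Moreover, for all $n\ge1$ and $1\le k\le n$, $T(n,k)$ equals the number of linear chord diagrams with $n$ chords having exactly $k$ LR pairs.
   Context: The second-order Eulerian number $E(n,k)$ is the number of permutations $w_1w_2\cdots w_{2n}$ of the multiset $\{1,1,2,2,\dots,n,n\}$ such that for each $m$, all entries between the two copies of $m$ are less than $m$, and which have exactly $k$ ascents (indices $i$ with $w_i<w_{i+1}$). A linear chord diagram with $n$ chords is a partition of $[2n]=\{1,\dots,2n\}$ into $n$ blocks of size two, called chords; for a chord $\{a,b\}$ with $a<b$, $a$ is its startpoint and $b$ its endpoint. An LR pair is a pair of consecutive integers $(i,i+1)$ such that $i$ is the startpoint of some chord and $i+1$ is the endpoint of some (possibly different) chord. -}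

module Defs where

open import Data.Nat using (ℕ; zero; suc; _+_; _*_; _∸_; _<ᵇ_; _≡ᵇ_; _≤ᵇ_)
open import Data.Bool using (Bool; true; false; _∧_; _∨_; not; if_then_else_)
open import Data.List using (List; []; _∷_; map; concatMap; length; filterᵇ; dropWhileᵇ; takeWhileᵇ; drop; upTo; concat)
open import Data.Product using (_×_; _,_; proj₁; proj₂)
open import Data.Bool.ListAction using (all; any)

words : {A : Set} → ℕ → List A → List (List A)
words zero    xs = [] ∷ []
words (suc L) xs = concatMap (λ x → map (x ∷_) (words L xs)) xs

range : ℕ → ℕ → List ℕ
range a len = map (a +_) (upTo len)

occ : ℕ → List ℕ → ℕ
occ m []      = 0
occ m (x ∷ w) = if m ≡ᵇ x then suc (occ m w) else occ m w

between : ℕ → List ℕ → List ℕ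
between m w = takeWhileᵇ (λ x → not (x ≡ᵇ m)) (drop 1 (dropWhileᵇ (λ x → not (x ≡ᵇ m)) w))

-- w is a permutation of the multiset {1,1,2,2,...,n,n}
-- (w is drawn from words over {1..n}; each value occurs exactly twice)
isMultisetPerm : ℕ → List ℕ → Bool
isMultisetPerm n w = all (λ m → occ m w ≡ᵇ 2) (range 1 n)

stirlingCond : ℕ → List ℕ → Bool
stirlingCond n w = all (λ m → all (λ x → x <ᵇ m) (between m w)) (range 1 n)

ascents : List ℕ → ℕ
ascents []            = 0
ascents (x ∷ [])      = 0
ascents (x ∷ y ∷ w)   = (if x <ᵇ y then 1 else 0) + ascents (y ∷ w)

stirlingPerms : ℕ → List (List ℕ)
stirlingPerms n = filterᵇ (λ w → isMultisetPerm n w ∧ stirlingCond n w) (words (2 * n) (range 1 n))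

E : ℕ → ℕ → ℕ
E n k = length (filterᵇ (λ w → ascents w ≡ᵇ k) (stirlingPerms n))

T : ℕ → ℕ → ℕ
T n k = if (1 ≤ᵇ k) ∧ (k ≤ᵇ n) then E n (n ∸ k) else 0

-- A set of chords is represented canonically as the list
-- of pairs (startpoint, endpoint) sorted by strictly increasing startpoint.
startsIncreasing : List (ℕ × ℕ) → Bool
startsIncreasing []            = true
startsIncreasing (p ∷ [])      = true
startsIncreasing (p ∷ q ∷ ps)  = (proj₁ p <ᵇ proj₁ q) ∧ startsIncreasing (q ∷ ps)

endpointsList : List (ℕ × ℕ) → List ℕ
endpointsList ps = concat (map (λ p → proj₁ p ∷ proj₂ p ∷ []) ps)

isChordDiagram : ℕ → List (ℕ × ℕ) → Bool
isChordDiagram n ps =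
  all (λ p → proj₁ p <ᵇ proj₂ p) ps
  ∧ startsIncreasing ps
  ∧ all (λ i → occ i (endpointsList ps) ≡ᵇ 1) (range 1 (2 * n))

pairs : ℕ → List (ℕ × ℕ)
pairs n = concatMap (λ a → map (λ b → (a , b)) (range 1 (2 * n))) (range 1 (2 * n))

chordDiagrams : ℕ → List (List (ℕ × ℕ))
chordDiagrams n = filterᵇ (isChordDiagram n) (words n (pairs n))

isStartpoint : List (ℕ × ℕ) → ℕ → Bool
isStartpoint ps i = any (λ p → proj₁ p ≡ᵇ i) ps

isEndpoint : List (ℕ × ℕ) → ℕ → Bool
isEndpoint ps i = any (λ p → proj₂ p ≡ᵇ i) ps

lrPairs : ℕ → List (ℕ × ℕ) → ℕ
lrPairs n ps = length (filterᵇ (λ i → isStartpoint ps i ∧ isEndpoint ps (suc i)) (range 1 (2 * n ∸ 1)))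

chordCount : ℕ → ℕ → ℕ
chordCount n k = length (filterᵇ (λ ps → lrPairs n ps ≡ᵇ k) (chordDiagrams n))

module Submission where

-- Both families of objects grow by one "insertion" that adds a new smallest
-- element: a Stirling permutation of order n+1 is obtained from one of order
-- n by adding 1 to every entry and inserting the block 1 1 into one of its
-- 2n+1 gaps; a chord diagram with n+1 chords is obtained from one with n
-- chords by shifting its points and adding the chord {1, g+2} for one of
-- 2n+1 choices of g.  Each insertion raises the statistic (ascents, resp. LR
-- pairs) by 0 or 1, and the number of gaps that do NOT raise it depends only
-- on its current value (a+1 for a ascents, n+l for l LR pairs).

open import Defs
open import Data.Nat using (ℕ; _+_; _*_; _∸_; _≤_)
open import Data.Nat using (_!)
open import Data.Product using (_×_)
open import Relation.Binary.PropositionalEquality using (_≡_)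

open import Data.Nat using (zero; suc; pred; _<_; z≤n; s≤s; _≡ᵇ_; _<ᵇ_; _≤ᵇ_; _≤?_)
open import Data.Nat.Properties
open import Data.Nat.Tactic.RingSolver using (solve-∀)
open import Data.Bool using (Bool; true; false; _∧_; not; if_then_else_)
open import Data.Bool.Properties using (T-≡; T?)
open import Data.Bool.ListAction using (all; any; and; or)
open import Data.List using (List; []; _∷_; map; concatMap; length; filterᵇ; takeWhileᵇ; dropWhileᵇ; drop; _++_)
open import Data.List using (upTo; applyUpTo; cartesianProduct; cartesianProductWith)
open import Data.List.Properties using (length-map; length-++; map-upTo; length-upTo; ∷-injective; map-∘; map-cong)
open import Data.List.Membership.Propositional using (_∈_)
open import Data.List.Membership.Propositional.Properties using (∈-map⁺; ∈-map⁻; ∈-filter⁺; ∈-filter⁻; ∈-upTo⁺; ∈-upTo⁻)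
open import Data.List.Membership.Propositional.Properties using (∈-cartesianProduct⁺; ∈-cartesianProduct⁻; ∈-cartesianProductWith⁺; ∈-cartesianProductWith⁻)
open import Data.List.Relation.Unary.Any using (here; there)
open import Data.List.Relation.Unary.Unique.Propositional using (Unique)
open import Data.List.Relation.Unary.AllPairs using ([]; _∷_)
open import Data.List.Relation.Unary.All using ([]; lookup)
open import Relation.Binary.Definitions using (tri<; tri≈; tri>)
import Data.List.Relation.Unary.Unique.Propositional.Properties as Unique
open import Data.Product using (_,_; proj₁; proj₂; ∃)
open import Data.Sum using (_⊎_; inj₁; inj₂)
open import Data.Empty using (⊥; ⊥-elim)
open import Data.Unit using (⊤; tt)
open import Function using (_∘_)
open import Function.Bundles using (Equivalence)
open import Relation.Nullary using (¬_; yes; no)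
open import Relation.Binary.PropositionalEquality using (refl; sym; trans; cong; cong₂; subst; _≢_; module ≡-Reasoning)

≡ᵇ⇒≡′ : ∀ m n → (m ≡ᵇ n) ≡ true → m ≡ n
≡ᵇ⇒≡′ m n e = ≡ᵇ⇒≡ m n (Equivalence.from T-≡ e)

≡⇒≡ᵇ′ : ∀ m n → m ≡ n → (m ≡ᵇ n) ≡ true
≡⇒≡ᵇ′ m n e = Equivalence.to T-≡ (≡⇒≡ᵇ m n e)

≢⇒≡ᵇ-false : ∀ m n → m ≢ n → (m ≡ᵇ n) ≡ false
≢⇒≡ᵇ-false m n m≢n with m ≡ᵇ n in eq
... | true  = ⊥-elim (m≢n (≡ᵇ⇒≡′ m n eq))
... | false = refl

≡ᵇ-refl : ∀ m → (m ≡ᵇ m) ≡ true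
≡ᵇ-refl m = ≡⇒≡ᵇ′ m m refl

≡ᵇ-sym : ∀ m n → (m ≡ᵇ n) ≡ (n ≡ᵇ m)
≡ᵇ-sym zero    zero    = refl
≡ᵇ-sym zero    (suc n) = refl
≡ᵇ-sym (suc m) zero    = refl
≡ᵇ-sym (suc m) (suc n) = ≡ᵇ-sym m n

<ᵇ⇒<′ : ∀ m n → (m <ᵇ n) ≡ true → m < n
<ᵇ⇒<′ m n e = <ᵇ⇒< m n (Equivalence.from T-≡ e)

<⇒<ᵇ′ : ∀ {m n} → m < n → (m <ᵇ n) ≡ true
<⇒<ᵇ′ m<n = Equivalence.to T-≡ (<⇒<ᵇ m<n)

≮⇒<ᵇ-false : ∀ m n → ¬ m < n → (m <ᵇ n) ≡ false
≮⇒<ᵇ-false m n m≮n with m <ᵇ n in eq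
... | true  = ⊥-elim (m≮n (<ᵇ⇒<′ m n eq))
... | false = refl

≤⇒≤ᵇ′ : ∀ {m n} → m ≤ n → (m ≤ᵇ n) ≡ true
≤⇒≤ᵇ′ m≤n = Equivalence.to T-≡ (≤⇒≤ᵇ m≤n)

≰⇒≤ᵇ-false : ∀ m n → ¬ m ≤ n → (m ≤ᵇ n) ≡ false
≰⇒≤ᵇ-false m n m≰n with m ≤ᵇ n in eq
... | true  = ⊥-elim (m≰n (≤ᵇ⇒≤ m n (Equivalence.from T-≡ eq)))
... | false = refl

∧-true⁻ : ∀ {a b} → (a ∧ b) ≡ true → a ≡ true × b ≡ true
∧-true⁻ {true} {true} _ = refl , refl

∧-true⁺ : ∀ {a b} → a ≡ true → b ≡ true → (a ∧ b) ≡ true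
∧-true⁺ refl refl = refl

all-true⁻ : {A : Set} (p : A → Bool) (xs : List A) → all p xs ≡ true → ∀ {x} → x ∈ xs → p x ≡ true
all-true⁻ p (y ∷ xs) e (here refl) = proj₁ (∧-true⁻ e)
all-true⁻ p (y ∷ xs) e (there x∈xs) = all-true⁻ p xs (proj₂ (∧-true⁻ {p y} e)) x∈xs

all-true⁺ : {A : Set} (p : A → Bool) (xs : List A) → (∀ {x} → x ∈ xs → p x ≡ true) → all p xs ≡ true
all-true⁺ p []       h = refl
all-true⁺ p (y ∷ xs) h = ∧-true⁺ (h (here refl)) (all-true⁺ p xs (h ∘ there))

𝟙 : Bool → ℕ
𝟙 b = if b then 1 else 0

count : {A : Set} → (A → Bool) → List A → ℕ
count p []       = 0
count p (x ∷ xs) = 𝟙 (p x) + count p xs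

length-filterᵇ : {A : Set} (p : A → Bool) (xs : List A) → length (filterᵇ p xs) ≡ count p xs
length-filterᵇ p []       = refl
length-filterᵇ p (x ∷ xs) with p x
... | true  = cong suc (length-filterᵇ p xs)
... | false = length-filterᵇ p xs

∈-filterᵇ⁻ : {A : Set} (p : A → Bool) (xs : List A) {x : A} → x ∈ filterᵇ p xs → x ∈ xs × p x ≡ true
∈-filterᵇ⁻ p xs x∈ = let (x∈xs , px) = ∈-filter⁻ (T? ∘ p) x∈ in x∈xs , Equivalence.to T-≡ px

∈-filterᵇ⁺ : {A : Set} (p : A → Bool) (xs : List A) {x : A} → x ∈ xs → p x ≡ true → x ∈ filterᵇ p xs
∈-filterᵇ⁺ p xs x∈xs px = ∈-filter⁺ (T? ∘ p) x∈xs (Equivalence.from T-≡ px)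

count-++ : {A : Set} (p : A → Bool) (xs ys : List A) → count p (xs ++ ys) ≡ count p xs + count p ys
count-++ p []       ys = refl
count-++ p (x ∷ xs) ys = trans (cong (𝟙 (p x) +_) (count-++ p xs ys)) (sym (+-assoc (𝟙 (p x)) _ _))

count-map : {A B : Set} (p : B → Bool) (f : A → B) (xs : List A) → count p (map f xs) ≡ count (p ∘ f) xs
count-map p f []       = refl
count-map p f (x ∷ xs) = cong (𝟙 (p (f x)) +_) (count-map p f xs)

count-not : {A : Set} (p : A → Bool) (xs : List A) → count p xs + count (not ∘ p) xs ≡ length xs
count-not p []       = refl
count-not p (x ∷ xs) with p x
... | true  = cong suc (count-not p xs)
... | false = trans (+-suc (count p xs) _) (cong suc (count-not p xs))

count-false : {A : Set} (xs : List A) → count (λ _ → false) xs ≡ 0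
count-false []       = refl
count-false (x ∷ xs) = count-false xs

count-upTo-suc : (p : ℕ → Bool) (K : ℕ) → count p (upTo (suc K)) ≡ 𝟙 (p 0) + count (p ∘ suc) (upTo K)
count-upTo-suc p K = cong (𝟙 (p 0) +_) (trans (cong (count p) (sym (map-upTo suc K))) (count-map p suc (upTo K)))

-- A list without repetitions that injects into ys is no longer than ys.
-- This is the pigeonhole principle behind counting through a bijection.
module _ {A : Set} where

  remove : {x : A} {ys : List A} → x ∈ ys → List A
  remove {ys = y ∷ ys} (here _)    = ys
  remove {ys = y ∷ ys} (there x∈ys) = y ∷ remove x∈ys

  length-remove : {x : A} {ys : List A} (x∈ys : x ∈ ys) → length ys ≡ suc (length (remove x∈ys))
  length-remove (here _)     = refl
  length-remove (there x∈ys) = cong suc (length-remove x∈ys)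

  ∈-remove : {x z : A} {ys : List A} (x∈ys : x ∈ ys) → z ∈ ys → z ≢ x → z ∈ remove x∈ys
  ∈-remove (here refl)  (here refl)  z≢x = ⊥-elim (z≢x refl)
  ∈-remove (here refl)  (there z∈ys) z≢x = z∈ys
  ∈-remove (there x∈ys) (here refl)  z≢x = here refl
  ∈-remove (there x∈ys) (there z∈ys) z≢x = there (∈-remove x∈ys z∈ys z≢x)

injection-length-≤ : {A B : Set} {xs : List A} {ys : List B} (f : A → B) (g : B → A) → Unique xs
  → (∀ {x} → x ∈ xs → f x ∈ ys) → (∀ {x} → x ∈ xs → g (f x) ≡ x) → length xs ≤ length ys
injection-length-≤ {xs = []}     f g _ _ _ = z≤n
injection-length-≤ {xs = x ∷ xs} {ys} f g (x≢xs ∷ unique) maps-to left-inverse =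
  subst (suc (length xs) ≤_) (sym (length-remove fx∈ys)) (s≤s (injection-length-≤ f g unique maps-to′ (left-inverse ∘ there)))
  where
  fx∈ys = maps-to (here refl)
  maps-to′ : ∀ {z} → z ∈ xs → f z ∈ remove fx∈ys
  maps-to′ z∈xs = ∈-remove fx∈ys (maps-to (there z∈xs)) λ fz≡fx →
    lookup x≢xs z∈xs (trans (sym (left-inverse (here refl))) (trans (cong g (sym fz≡fx)) (left-inverse (there z∈xs))))

record ListBijection {A B : Set} (xs : List A) (ys : List B) : Set where
  field
    to       : A → B
    from     : B → A
    to∈      : ∀ {x} → x ∈ xs → to x ∈ ys
    from∈    : ∀ {y} → y ∈ ys → from y ∈ xs
    from∘to  : ∀ {x} → x ∈ xs → from (to x) ≡ x
    to∘from  : ∀ {y} → y ∈ ys → to (from y) ≡ y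

count-bijection : {A B : Set} {xs : List A} {ys : List B} → Unique xs → Unique ys
  → (φ : ListBijection xs ys) (q : B → Bool) → count (q ∘ ListBijection.to φ) xs ≡ count q ys
count-bijection {xs = xs} {ys} unique-xs unique-ys φ q = begin
  count (q ∘ to) xs                ≡⟨ length-filterᵇ (q ∘ to) xs ⟨
  length (filterᵇ (q ∘ to) xs)     ≡⟨ ≤-antisym (injection-length-≤ to from (Unique.filter⁺ (T? ∘ (q ∘ to)) unique-xs) forth (from∘to ∘ in-xs))
                                                (injection-length-≤ from to (Unique.filter⁺ (T? ∘ q) unique-ys) back (to∘from ∘ in-ys)) ⟩
  length (filterᵇ q ys)            ≡⟨ length-filterᵇ q ys ⟩
  count q ys                       ∎
  where
  open ≡-Reasoning
  open ListBijection φ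
  in-xs : ∀ {x} → x ∈ filterᵇ (q ∘ to) xs → x ∈ xs
  in-xs = proj₁ ∘ ∈-filterᵇ⁻ (q ∘ to) xs
  in-ys : ∀ {y} → y ∈ filterᵇ q ys → y ∈ ys
  in-ys = proj₁ ∘ ∈-filterᵇ⁻ q ys
  forth : ∀ {x} → x ∈ filterᵇ (q ∘ to) xs → to x ∈ filterᵇ q ys
  forth x∈ = let (x∈xs , qx) = ∈-filterᵇ⁻ (q ∘ to) xs x∈ in ∈-filterᵇ⁺ q ys (to∈ x∈xs) qx
  back : ∀ {y} → y ∈ filterᵇ q ys → from y ∈ filterᵇ (q ∘ to) xs
  back y∈ = let (y∈ys , qy) = ∈-filterᵇ⁻ q ys y∈ in
    ∈-filterᵇ⁺ (q ∘ to) xs (from∈ y∈ys) (subst (λ z → q z ≡ true) (sym (to∘from y∈ys)) qy)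

indicator-subst : ∀ (f : ℕ → ℕ) a j → f a * 𝟙 (a ≡ᵇ j) ≡ f j * 𝟙 (a ≡ᵇ j)
indicator-subst f a j with a ≡ᵇ j in eq
... | true  = cong (λ z → f z * 1) (≡ᵇ⇒≡′ a j eq)
... | false = trans (*-zeroʳ (f a)) (sym (*-zeroʳ (f j)))

count-by-step : {A : Set} (δ : A → Bool) (t : A → ℕ) (s j : ℕ) (xs : List A)
  → (∀ {x} → x ∈ xs → t x ≡ 𝟙 (δ x) + s)
  → count (λ x → t x ≡ᵇ j) xs ≡ count (not ∘ δ) xs * 𝟙 (s ≡ᵇ j) + count δ xs * 𝟙 (suc s ≡ᵇ j)
count-by-step δ t s j []       step = refl
count-by-step δ t s j (x ∷ xs) step
  rewrite step (here refl) | count-by-step δ t s j xs (step ∘ there) with δ x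
... | true  = raise (𝟙 (suc s ≡ᵇ j)) (count (not ∘ δ) xs) (count δ xs) (𝟙 (s ≡ᵇ j))
  where raise : ∀ e c₀ c₁ e₀ → e + (c₀ * e₀ + c₁ * e) ≡ c₀ * e₀ + (e + c₁ * e)
        raise = solve-∀
... | false = keep (𝟙 (s ≡ᵇ j)) (count (not ∘ δ) xs) (count δ xs) (𝟙 (suc s ≡ᵇ j))
  where keep : ∀ e c₀ c₁ e₁ → e + (c₀ * e + c₁ * e₁) ≡ (e + c₀ * e) + c₁ * e₁
        keep = solve-∀

count-cartesianProduct : {A C : Set} (q : A × C → Bool) (D : List A) (G : List C)
  (c₁ c₂ : ℕ) (p₁ p₂ : A → Bool)
  → (∀ {a} → a ∈ D → count (λ g → q (a , g)) G ≡ c₁ * 𝟙 (p₁ a) + c₂ * 𝟙 (p₂ a))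
  → count q (cartesianProduct D G) ≡ c₁ * count p₁ D + c₂ * count p₂ D
count-cartesianProduct q []      G c₁ c₂ p₁ p₂ row = zeros c₁ c₂
  where zeros : ∀ c₁ c₂ → 0 ≡ c₁ * 0 + c₂ * 0
        zeros = solve-∀
count-cartesianProduct q (a ∷ D) G c₁ c₂ p₁ p₂ row = begin
  count q (map (a ,_) G ++ cartesianProduct D G)
    ≡⟨ count-++ q (map (a ,_) G) _ ⟩
  count q (map (a ,_) G) + count q (cartesianProduct D G)
    ≡⟨ cong₂ _+_ (trans (count-map q (a ,_) G) (row (here refl))) (count-cartesianProduct q D G c₁ c₂ p₁ p₂ (row ∘ there)) ⟩
  (c₁ * 𝟙 (p₁ a) + c₂ * 𝟙 (p₂ a)) + (c₁ * count p₁ D + c₂ * count p₂ D)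
    ≡⟨ regroup c₁ c₂ (𝟙 (p₁ a)) (𝟙 (p₂ a)) (count p₁ D) (count p₂ D) ⟩
  c₁ * (𝟙 (p₁ a) + count p₁ D) + c₂ * (𝟙 (p₂ a) + count p₂ D) ∎
  where
  open ≡-Reasoning
  regroup : ∀ c₁ c₂ u v x y → (c₁ * u + c₂ * v) + (c₁ * x + c₂ * y) ≡ c₁ * (u + x) + c₂ * (v + y)
  regroup = solve-∀

record Insertion {A B : Set} (D : List A) (D' : List B) (N : ℕ) : Set where
  field
    unique     : Unique D
    unique'    : Unique D'
    insert     : A × ℕ → B
    extract    : B → A × ℕ
    insert∈    : ∀ {a g} → a ∈ D → g ≤ N → insert (a , g) ∈ D'
    extract∈   : ∀ {b} → b ∈ D' → proj₁ (extract b) ∈ D × proj₂ (extract b) ≤ N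
    extract∘insert : ∀ {a g} → a ∈ D → g ≤ N → extract (insert (a , g)) ≡ (a , g)
    insert∘extract : ∀ {b} → b ∈ D' → insert (extract b) ≡ b

  gaps : List ℕ
  gaps = upTo (suc N)

  gap≤ : ∀ {g} → g ∈ gaps → g ≤ N
  gap≤ = ≤-pred ∘ ∈-upTo⁻

  bijection : ListBijection (cartesianProduct D gaps) D'
  bijection = record
    { to      = insert
    ; from    = extract
    ; to∈     = λ {(a , g)} m → let (a∈ , g∈) = ∈-cartesianProduct⁻ D gaps m in insert∈ a∈ (gap≤ g∈)
    ; from∈   = λ b∈ → let (a∈ , g≤) = extract∈ b∈ in ∈-cartesianProduct⁺ a∈ (∈-upTo⁺ (s≤s g≤))
    ; from∘to = λ {(a , g)} m → let (a∈ , g∈) = ∈-cartesianProduct⁻ D gaps m in extract∘insert a∈ (gap≤ g∈)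
    ; to∘from = insert∘extract
    }

-- Suppose inserting at gap g raises the statistic
-- s to s' = s or s + 1 (according to rises a g), and that the number of gaps
-- which do not raise it is stays (s a).  Then the number of b ∈ D' with
-- s' b = j is stays j times the number of a with s a = j, plus the number of
-- raising gaps, N + 1 - stays (j - 1), times the number of a with s a = j - 1.
insertion-recurrence : {A B : Set} {D : List A} {D' : List B} {N : ℕ} (ins : Insertion D D' N)
  (s : A → ℕ) (s' : B → ℕ) (rises : A → ℕ → Bool) (stays : ℕ → ℕ)
  → (∀ {a g} → a ∈ D → g ≤ N → s' (Insertion.insert ins (a , g)) ≡ 𝟙 (rises a g) + s a)
  → (∀ {a} → a ∈ D → count (not ∘ rises a) (upTo (suc N)) ≡ stays (s a))
  → ∀ j → count (λ b → s' b ≡ᵇ j) D'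
        ≡ stays j * count (λ a → s a ≡ᵇ j) D + (suc N ∸ stays (pred j)) * count (λ a → suc (s a) ≡ᵇ j) D
insertion-recurrence {D = D} {D'} {N} ins s s' rises stays step non-raising j = begin
  count (λ b → s' b ≡ᵇ j) D'
    ≡⟨ count-bijection (Unique.cartesianProduct⁺ unique (Unique.upTo⁺ (suc N))) unique' bijection (λ b → s' b ≡ᵇ j) ⟨
  count (λ p → s' (insert p) ≡ᵇ j) (cartesianProduct D gaps)
    ≡⟨ count-cartesianProduct _ D gaps (stays j) (suc N ∸ stays (pred j)) _ _ row ⟩
  stays j * count (λ a → s a ≡ᵇ j) D + (suc N ∸ stays (pred j)) * count (λ a → suc (s a) ≡ᵇ j) D ∎
  where
  open ≡-Reasoning
  open Insertion ins
  raising : ∀ {a} → a ∈ D → count (rises a) gaps ≡ suc N ∸ stays (s a)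
  raising {a} a∈ = begin
    count (rises a) gaps                                              ≡⟨ m+n∸n≡m _ (stays (s a)) ⟨
    count (rises a) gaps + stays (s a) ∸ stays (s a)                  ≡⟨ cong (λ z → count (rises a) gaps + z ∸ stays (s a)) (non-raising a∈) ⟨
    count (rises a) gaps + count (not ∘ rises a) gaps ∸ stays (s a)   ≡⟨ cong (_∸ stays (s a)) (trans (count-not (rises a) gaps) (length-upTo (suc N))) ⟩
    suc N ∸ stays (s a)                                               ∎
  row : ∀ {a} → a ∈ D → count (λ g → s' (insert (a , g)) ≡ᵇ j) gaps
                        ≡ stays j * 𝟙 (s a ≡ᵇ j) + (suc N ∸ stays (pred j)) * 𝟙 (suc (s a) ≡ᵇ j)
  row {a} a∈ = begin
    count (λ g → s' (insert (a , g)) ≡ᵇ j) gaps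
      ≡⟨ count-by-step (rises a) _ (s a) j gaps (λ g∈ → step a∈ (gap≤ g∈)) ⟩
    count (not ∘ rises a) gaps * 𝟙 (s a ≡ᵇ j) + count (rises a) gaps * 𝟙 (suc (s a) ≡ᵇ j)
      ≡⟨ cong₂ (λ x y → x * 𝟙 (s a ≡ᵇ j) + y * 𝟙 (suc (s a) ≡ᵇ j)) (non-raising a∈) (raising a∈) ⟩
    stays (s a) * 𝟙 (s a ≡ᵇ j) + (suc N ∸ stays (s a)) * 𝟙 (suc (s a) ≡ᵇ j)
      ≡⟨ cong₂ _+_ (indicator-subst stays (s a) j) (indicator-subst (λ b → suc N ∸ stays (pred b)) (suc (s a)) j) ⟩
    stays j * 𝟙 (s a ≡ᵇ j) + (suc N ∸ stays (pred j)) * 𝟙 (suc (s a) ≡ᵇ j) ∎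

∈-range⁻ : ∀ a L {x} → x ∈ range a L → a ≤ x × x < a + L
∈-range⁻ a L x∈ with ∈-map⁻ (a +_) x∈
... | i , i∈ , refl = m≤m+n a i , +-monoʳ-< a (∈-upTo⁻ i∈)

∈-range⁺ : ∀ a L {x} → a ≤ x → x < a + L → x ∈ range a L
∈-range⁺ a L {x} a≤x x<a+L =
  subst (_∈ range a L) (m+[n∸m]≡n a≤x)
        (∈-map⁺ (a +_) (∈-upTo⁺ (+-cancelˡ-< a (x ∸ a) L (subst (_< a + L) (sym (m+[n∸m]≡n a≤x)) x<a+L))))

unique-range : ∀ a L → Unique (range a L)
unique-range a L = Unique.map⁺ (+-cancelˡ-≡ a _ _) (Unique.upTo⁺ L)

concatMap-map : {A B C : Set} (f : A → B → C) (xs : List A) (ys : List B)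
  → concatMap (λ x → map (f x) ys) xs ≡ cartesianProductWith f xs ys
concatMap-map f []       ys = refl
concatMap-map f (x ∷ xs) ys = cong (map (f x) ys ++_) (concatMap-map f xs ys)

∈-words⁻ : {A : Set} (L : ℕ) (xs : List A) {w : List A} → w ∈ words L xs
  → length w ≡ L × (∀ {y} → y ∈ w → y ∈ xs)
∈-words⁻ zero    xs (here refl) = refl , λ ()
∈-words⁻ (suc L) xs w∈ with ∈-cartesianProductWith⁻ _∷_ xs (words L xs) (subst (_ ∈_) (concatMap-map _∷_ xs (words L xs)) w∈)
... | y , w , y∈ , w∈′ , refl = let (len , entries) = ∈-words⁻ L xs w∈′ in
  cong suc len , λ { (here refl) → y∈ ; (there z∈) → entries z∈ }

∈-words⁺ : {A : Set} (xs : List A) (w : List A) → (∀ {y} → y ∈ w → y ∈ xs) → w ∈ words (length w) xs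
∈-words⁺ xs []      entries = here refl
∈-words⁺ xs (y ∷ w) entries = subst (_ ∈_) (sym (concatMap-map _∷_ xs (words (length w) xs)))
  (∈-cartesianProductWith⁺ _∷_ (entries (here refl)) (∈-words⁺ xs w (entries ∘ there)))

unique-words : {A : Set} (L : ℕ) {xs : List A} → Unique xs → Unique (words L xs)
unique-words zero    unique-xs = [] ∷ []
unique-words (suc L) {xs} unique-xs = subst Unique (sym (concatMap-map _∷_ xs (words L xs)))
  (Unique.cartesianProductWith⁺ _∷_ ∷-injective unique-xs (unique-words L unique-xs))

occ-cons-≢ : ∀ m x w → (x ≡ᵇ m) ≡ false → occ m (x ∷ w) ≡ occ m w
occ-cons-≢ m x w x≢m rewrite ≡ᵇ-sym m x | x≢m = refl

occ-++ : ∀ m (u v : List ℕ) → occ m (u ++ v) ≡ occ m u + occ m v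
occ-++ m []      v = refl
occ-++ m (x ∷ u) v with m ≡ᵇ x
... | true  = cong suc (occ-++ m u v)
... | false = occ-++ m u v

occ≢0⇒∈ : ∀ m w → occ m w ≢ 0 → m ∈ w
occ≢0⇒∈ m []      occ≢0 = ⊥-elim (occ≢0 refl)
occ≢0⇒∈ m (x ∷ w) occ≢0 with m ≡ᵇ x in eq
... | true  = here (≡ᵇ⇒≡′ m x eq)
... | false = there (occ≢0⇒∈ m w occ≢0)

occ≡0⇒∉ : ∀ m w → occ m w ≡ 0 → ¬ m ∈ w
occ≡0⇒∉ m (x ∷ w) occ≡0 m∈ with m ≡ᵇ x in eq | m∈
... | false | here refl = case (trans (sym eq) (≡ᵇ-refl m))
  where case : false ≡ true → ⊥
        case ()
... | false | there m∈w = occ≡0⇒∉ m w occ≡0 m∈w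

∉⇒occ≡0 : ∀ m w → (∀ {y} → y ∈ w → y ≢ m) → occ m w ≡ 0
∉⇒occ≡0 m []      ∉ = refl
∉⇒occ≡0 m (x ∷ w) ∉ rewrite ≢⇒≡ᵇ-false m x (λ m≡x → ∉ (here refl) (sym m≡x)) = ∉⇒occ≡0 m w (∉ ∘ there)

nestedAt : ℕ → List ℕ → Bool
nestedAt m w = all (λ x → x <ᵇ m) (between m w)

record IsStirling (n : ℕ) (w : List ℕ) : Set where
  field
    length≡ : length w ≡ 2 * n
    entry   : ∀ {y} → y ∈ w → 1 ≤ y × y ≤ n
    twice   : ∀ m → 1 ≤ m → m ≤ n → occ m w ≡ 2
    nested  : ∀ m → 1 ≤ m → m ≤ n → nestedAt m w ≡ true

  positive : ∀ {y} → y ∈ w → 1 ≤ y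
  positive = proj₁ ∘ entry

∈-stirlingPerms⁻ : ∀ n {w} → w ∈ stirlingPerms n → IsStirling n w
∈-stirlingPerms⁻ n {w} w∈ = record
  { length≡ = len
  ; entry   = λ y∈ → let (1≤y , y<1+n) = ∈-range⁻ 1 n (entries y∈) in 1≤y , ≤-pred y<1+n
  ; twice   = λ m 1≤m m≤n → ≡ᵇ⇒≡′ _ _ (all-true⁻ _ (range 1 n) twice-test (∈-range⁺ 1 n 1≤m (s≤s m≤n)))
  ; nested  = λ m 1≤m m≤n → all-true⁻ _ (range 1 n) nested-test (∈-range⁺ 1 n 1≤m (s≤s m≤n))
  }
  where
  w∈words = proj₁ (∈-filterᵇ⁻ _ (words (2 * n) (range 1 n)) w∈)
  len     = proj₁ (∈-words⁻ (2 * n) (range 1 n) w∈words)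
  entries = proj₂ (∈-words⁻ (2 * n) (range 1 n) w∈words)
  twice-test  = proj₁ (∧-true⁻ (proj₂ (∈-filterᵇ⁻ _ (words (2 * n) (range 1 n)) w∈)))
  nested-test = proj₂ (∧-true⁻ {isMultisetPerm n w} (proj₂ (∈-filterᵇ⁻ _ (words (2 * n) (range 1 n)) w∈)))

∈-stirlingPerms⁺ : ∀ n {w} → IsStirling n w → w ∈ stirlingPerms n
∈-stirlingPerms⁺ n {w} s = ∈-filterᵇ⁺ _ (words (2 * n) (range 1 n))
  (subst (λ L → w ∈ words L (range 1 n)) length≡ (∈-words⁺ (range 1 n) w λ y∈ → let (1≤y , y≤n) = entry y∈ in ∈-range⁺ 1 n 1≤y (s≤s y≤n)))
  (∧-true⁺ (all-true⁺ _ (range 1 n) λ m∈ → let (1≤m , m<1+n) = ∈-range⁻ 1 n m∈ in ≡⇒≡ᵇ′ _ _ (twice _ 1≤m (≤-pred m<1+n)))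
           (all-true⁺ _ (range 1 n) λ m∈ → let (1≤m , m<1+n) = ∈-range⁻ 1 n m∈ in nested _ 1≤m (≤-pred m<1+n)))
  where open IsStirling s

unique-stirlingPerms : ∀ n → Unique (stirlingPerms n)
unique-stirlingPerms n = Unique.filter⁺ _ (unique-words (2 * n) (unique-range 1 n))

takeWhileᵇ-map : ∀ (p : ℕ → Bool) (f : ℕ → ℕ) w → takeWhileᵇ p (map f w) ≡ map f (takeWhileᵇ (p ∘ f) w)
takeWhileᵇ-map p f []      = refl
takeWhileᵇ-map p f (x ∷ w) with p (f x)
... | true  = cong (f x ∷_) (takeWhileᵇ-map p f w)
... | false = refl

dropWhileᵇ-map : ∀ (p : ℕ → Bool) (f : ℕ → ℕ) w → dropWhileᵇ p (map f w) ≡ map f (dropWhileᵇ (p ∘ f) w)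
dropWhileᵇ-map p f []      = refl
dropWhileᵇ-map p f (x ∷ w) with p (f x)
... | true  = dropWhileᵇ-map p f w
... | false = refl

drop1-map : ∀ (f : ℕ → ℕ) w → drop 1 (map f w) ≡ map f (drop 1 w)
drop1-map f []      = refl
drop1-map f (x ∷ w) = refl

between-map-suc : ∀ m w → between (suc m) (map suc w) ≡ map suc (between m w)
between-map-suc m w = begin
  takeWhileᵇ ≢m+1 (drop 1 (dropWhileᵇ ≢m+1 (map suc w)))
    ≡⟨ cong (takeWhileᵇ ≢m+1 ∘ drop 1) (dropWhileᵇ-map ≢m+1 suc w) ⟩
  takeWhileᵇ ≢m+1 (drop 1 (map suc (dropWhileᵇ ≢m w)))
    ≡⟨ cong (takeWhileᵇ ≢m+1) (drop1-map suc (dropWhileᵇ ≢m w)) ⟩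
  takeWhileᵇ ≢m+1 (map suc (drop 1 (dropWhileᵇ ≢m w)))
    ≡⟨ takeWhileᵇ-map ≢m+1 suc (drop 1 (dropWhileᵇ ≢m w)) ⟩
  map suc (between m w) ∎
  where
  open ≡-Reasoning
  ≢m ≢m+1 : ℕ → Bool
  ≢m   x = not (x ≡ᵇ m)
  ≢m+1 x = not (x ≡ᵇ suc m)

all-map : {A B : Set} (p : B → Bool) (f : A → B) (xs : List A) → all p (map f xs) ≡ all (p ∘ f) xs
all-map p f xs = cong and (sym (map-∘ xs))

nestedAt-map-suc : ∀ m w → nestedAt (suc m) (map suc w) ≡ nestedAt m w
nestedAt-map-suc m w = trans (cong (all (λ x → x <ᵇ suc m)) (between-map-suc m w)) (all-map (λ x → x <ᵇ suc m) suc (between m w))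

occ-map-suc : ∀ m w → occ (suc m) (map suc w) ≡ occ m w
occ-map-suc m []      = refl
occ-map-suc m (x ∷ w) with m ≡ᵇ x
... | true  = cong suc (occ-map-suc m w)
... | false = occ-map-suc m w

ascents-map-suc : ∀ w → ascents (map suc w) ≡ ascents w
ascents-map-suc []          = refl
ascents-map-suc (x ∷ [])    = refl
ascents-map-suc (x ∷ y ∷ w) = cong (𝟙 (x <ᵇ y) +_) (ascents-map-suc (y ∷ w))

map-pred-suc : ∀ w → map pred (map suc w) ≡ w
map-pred-suc []      = refl
map-pred-suc (x ∷ w) = cong (x ∷_) (map-pred-suc w)

map-suc-pred : ∀ w → (∀ {y} → y ∈ w → 1 ≤ y) → map suc (map pred w) ≡ w
map-suc-pred []          positive = refl
map-suc-pred (suc x ∷ w) positive = cong (suc x ∷_) (map-suc-pred w (positive ∘ there))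
map-suc-pred (zero ∷ w)  positive with positive (here refl)
... | ()

occ1-map-suc : ∀ w → (∀ {y} → y ∈ w → 1 ≤ y) → occ 1 (map suc w) ≡ 0
occ1-map-suc w positive = trans (occ-map-suc 0 w) (∉⇒occ≡0 0 w λ { y∈ refl → case (positive y∈) })
  where case : 1 ≤ 0 → ⊥
        case ()

-- Inserting the block 1 1 into gap g of a word (any g ≥ length w is the end).

insert11 : ℕ → List ℕ → List ℕ
insert11 zero    w       = 1 ∷ 1 ∷ w
insert11 (suc g) []      = 1 ∷ 1 ∷ []
insert11 (suc g) (x ∷ w) = x ∷ insert11 g w

insert11-[] : ∀ g → insert11 g [] ≡ 1 ∷ 1 ∷ []
insert11-[] zero    = refl
insert11-[] (suc g) = refl

length-insert11 : ∀ g u → length (insert11 g u) ≡ 2 + length u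
length-insert11 zero    u       = refl
length-insert11 (suc g) []      = refl
length-insert11 (suc g) (x ∷ u) = cong suc (length-insert11 g u)

∈-insert11 : ∀ g u {y} → y ∈ insert11 g u → y ≡ 1 ⊎ y ∈ u
∈-insert11 zero    u       (here refl)         = inj₁ refl
∈-insert11 zero    u       (there (here refl)) = inj₁ refl
∈-insert11 zero    u       (there (there y∈))  = inj₂ y∈
∈-insert11 (suc g) []      (here refl)         = inj₁ refl
∈-insert11 (suc g) []      (there (here refl)) = inj₁ refl
∈-insert11 (suc g) (x ∷ u) (here refl)         = inj₂ (here refl)
∈-insert11 (suc g) (x ∷ u) (there y∈) with ∈-insert11 g u y∈
... | inj₁ y≡1 = inj₁ y≡1
... | inj₂ y∈u = inj₂ (there y∈u)

occ1-insert11 : ∀ g u → occ 1 (insert11 g u) ≡ 2 + occ 1 u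
occ1-insert11 zero    u       = refl
occ1-insert11 (suc g) []      = refl
occ1-insert11 (suc g) (x ∷ u) with 1 ≡ᵇ x
... | true  = trans (cong suc (occ1-insert11 g u)) (sym (+-suc 2 _))
... | false = occ1-insert11 g u

occ-insert11 : ∀ m g u → occ (suc (suc m)) (insert11 g u) ≡ occ (suc (suc m)) u
occ-insert11 m zero    u       = refl
occ-insert11 m (suc g) []      = refl
occ-insert11 m (suc g) (x ∷ u) with suc (suc m) ≡ᵇ x
... | true  = cong suc (occ-insert11 m g u)
... | false = occ-insert11 m g u

nestedAt-insert11 : ∀ m g u → nestedAt (suc (suc m)) (insert11 g u) ≡ nestedAt (suc (suc m)) u
nestedAt-insert11 m zero    u       = refl
nestedAt-insert11 m (suc g) []      = refl
nestedAt-insert11 m (suc g) (x ∷ u) with x ≡ᵇ suc (suc m)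
... | true  = below g u
  where
  -- the block 1 1 is below m + 2, so it does not matter inside the segment
  below : ∀ g u → all (λ x → x <ᵇ suc (suc m)) (takeWhileᵇ (λ x → not (x ≡ᵇ suc (suc m))) (insert11 g u))
                ≡ all (λ x → x <ᵇ suc (suc m)) (takeWhileᵇ (λ x → not (x ≡ᵇ suc (suc m))) u)
  below zero    u       = refl
  below (suc g) []      = refl
  below (suc g) (x ∷ u) with x ≡ᵇ suc (suc m)
  ... | true  = refl
  ... | false = cong ((x <ᵇ suc (suc m)) ∧_) (below g u)
... | false = nestedAt-insert11 m g u

occ-cons-≡0 : ∀ m x u → occ m (x ∷ u) ≡ 0 → (x ≡ᵇ m) ≡ false × occ m u ≡ 0
occ-cons-≡0 m x u occ≡0 with m ≡ᵇ x in eq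
... | false = trans (≡ᵇ-sym x m) eq , occ≡0

between1-insert11 : ∀ g u → occ 1 u ≡ 0 → between 1 (insert11 g u) ≡ []
between1-insert11 zero    u       _     = refl
between1-insert11 (suc g) []      _     = refl
between1-insert11 (suc g) (x ∷ u) occ≡0 with occ-cons-≡0 1 x u occ≡0
... | x≢1 , occ≡0′ rewrite x≢1 = between1-insert11 g u occ≡0′

-- Put between neighbours x and y (with all
-- entries ≥ 2), the block 1 1 replaces the possible ascent x < y by the
-- ascent 1 < y; at the front it adds the ascent 1 < y; at the end nothing.

raisesAfter : ℕ → List ℕ → ℕ → Bool
raisesAfter x []      g       = false
raisesAfter x (y ∷ u) zero    = not (x <ᵇ y)
raisesAfter x (y ∷ u) (suc g) = raisesAfter y u g

raises : List ℕ → ℕ → Bool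
raises []      g       = false
raises (y ∷ u) zero    = true
raises (y ∷ u) (suc g) = raisesAfter y u g

AtLeast2 : List ℕ → Set
AtLeast2 u = ∀ {y} → y ∈ u → 2 ≤ y

ascents-insert11-after : ∀ x u g → 2 ≤ x → AtLeast2 u → ascents (x ∷ insert11 g u) ≡ 𝟙 (raisesAfter x u g) + ascents (x ∷ u)
ascents-insert11-after zero          u       g     ()          _
ascents-insert11-after (suc zero)    u       g     (s≤s ())    _
ascents-insert11-after (suc (suc x)) []      g     _ _ rewrite insert11-[] g = refl
ascents-insert11-after (suc (suc x)) (y ∷ u) zero  _ ≥2 with ≥2 (here refl)
... | s≤s (s≤s _) with suc (suc x) <ᵇ y
...   | true  = refl
...   | false = refl
ascents-insert11-after x (y ∷ u) (suc g) x≥2 ≥2 = begin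
  𝟙 (x <ᵇ y) + ascents (y ∷ insert11 g u)                  ≡⟨ cong (𝟙 (x <ᵇ y) +_) (ascents-insert11-after y u g (≥2 (here refl)) (≥2 ∘ there)) ⟩
  𝟙 (x <ᵇ y) + (𝟙 (raisesAfter y u g) + ascents (y ∷ u))   ≡⟨ +-comm-left (𝟙 (x <ᵇ y)) (𝟙 (raisesAfter y u g)) (ascents (y ∷ u)) ⟩
  𝟙 (raisesAfter y u g) + (𝟙 (x <ᵇ y) + ascents (y ∷ u))   ∎
  where
  open ≡-Reasoning
  +-comm-left : ∀ a b c → a + (b + c) ≡ b + (a + c)
  +-comm-left = solve-∀

ascents-insert11 : ∀ u g → AtLeast2 u → ascents (insert11 g u) ≡ 𝟙 (raises u g) + ascents u
ascents-insert11 []      g       ≥2 rewrite insert11-[] g = refl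
ascents-insert11 (y ∷ u) zero    ≥2 with ≥2 (here refl)
... | s≤s (s≤s _) = refl
ascents-insert11 (y ∷ u) (suc g) ≥2 = ascents-insert11-after y u g (≥2 (here refl)) (≥2 ∘ there)

non-raising-after : ∀ x u → count (not ∘ raisesAfter x u) (upTo (suc (length u))) ≡ suc (ascents (x ∷ u))
non-raising-after x []      = refl
non-raising-after x (y ∷ u) = begin
  count (not ∘ raisesAfter x (y ∷ u)) (upTo (suc (suc (length u))))
    ≡⟨ count-upTo-suc (not ∘ raisesAfter x (y ∷ u)) (suc (length u)) ⟩
  𝟙 (not (not (x <ᵇ y))) + count (not ∘ raisesAfter y u) (upTo (suc (length u)))
    ≡⟨ cong (𝟙 (not (not (x <ᵇ y))) +_) (non-raising-after y u) ⟩
  𝟙 (not (not (x <ᵇ y))) + suc (ascents (y ∷ u))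
    ≡⟨ shift (x <ᵇ y) ⟩
  suc (𝟙 (x <ᵇ y) + ascents (y ∷ u)) ∎
  where
  open ≡-Reasoning
  shift : ∀ b → 𝟙 (not (not b)) + suc (ascents (y ∷ u)) ≡ suc (𝟙 b + ascents (y ∷ u))
  shift true  = refl
  shift false = refl

non-raising : ∀ u → count (not ∘ raises u) (upTo (suc (length u))) ≡ suc (ascents u)
non-raising []      = refl
non-raising (y ∷ u) = trans (count-upTo-suc (not ∘ raises (y ∷ u)) (suc (length u))) (non-raising-after y u)

delete1s : List ℕ → List ℕ
delete1s []      = []
delete1s (x ∷ w) = if x ≡ᵇ 1 then delete1s w else x ∷ delete1s w

index1 : List ℕ → ℕ
index1 []      = 0
index1 (x ∷ w) = if x ≡ᵇ 1 then 0 else suc (index1 w)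

delete1s-insert11 : ∀ g u → delete1s (insert11 g u) ≡ delete1s u
delete1s-insert11 zero    u       = refl
delete1s-insert11 (suc g) []      = refl
delete1s-insert11 (suc g) (x ∷ u) with x ≡ᵇ 1
... | true  = delete1s-insert11 g u
... | false = cong (x ∷_) (delete1s-insert11 g u)

delete1s-no1 : ∀ u → occ 1 u ≡ 0 → delete1s u ≡ u
delete1s-no1 []      _     = refl
delete1s-no1 (x ∷ u) occ≡0 with occ-cons-≡0 1 x u occ≡0
... | x≢1 , occ≡0′ rewrite x≢1 = cong (x ∷_) (delete1s-no1 u occ≡0′)

index1-insert11 : ∀ g u → g ≤ length u → occ 1 u ≡ 0 → index1 (insert11 g u) ≡ g
index1-insert11 zero    u       _       _     = refl
index1-insert11 (suc g) (x ∷ u) (s≤s g≤) occ≡0 with occ-cons-≡0 1 x u occ≡0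
... | x≢1 , occ≡0′ rewrite x≢1 = cong suc (index1-insert11 g u g≤ occ≡0′)

insert11-++ : ∀ u v → insert11 (length u) (u ++ v) ≡ u ++ 1 ∷ 1 ∷ v
insert11-++ []      v = refl
insert11-++ (x ∷ u) v = cong (x ∷_) (insert11-++ u v)

delete1s-++ : ∀ u v → occ 1 u ≡ 0 → occ 1 v ≡ 0 → delete1s (u ++ 1 ∷ 1 ∷ v) ≡ u ++ v
delete1s-++ []      v _     no1-v = delete1s-no1 v no1-v
delete1s-++ (x ∷ u) v no1-u no1-v with occ-cons-≡0 1 x u no1-u
... | x≢1 , no1-u′ rewrite x≢1 = cong (x ∷_) (delete1s-++ u v no1-u′ no1-v)

index1-++ : ∀ u v → occ 1 u ≡ 0 → index1 (u ++ 1 ∷ 1 ∷ v) ≡ length u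
index1-++ []      v _     = refl
index1-++ (x ∷ u) v no1-u with occ-cons-≡0 1 x u no1-u
... | x≢1 , no1-u′ rewrite x≢1 = cong suc (index1-++ u v no1-u′)

record Split11 (w : List ℕ) : Set where
  field
    left right : List ℕ
    w≡    : w ≡ left ++ 1 ∷ 1 ∷ right
    no1-l : occ 1 left ≡ 0
    no1-r : occ 1 right ≡ 0

split11 : ∀ w → (∀ {y} → y ∈ w → 1 ≤ y) → occ 1 w ≡ 2 → nestedAt 1 w ≡ true → Split11 w
split11 []      positive () _
split11 (x ∷ w) positive twice nested with x ≡ᵇ 1 in x≟1
... | false = let s = split11 w (positive ∘ there) (trans (sym (occ-cons-≢ 1 x w x≟1)) twice) nested
                  open Split11 s
              in record { left = x ∷ left ; right = right ; w≡ = cong (x ∷_) w≡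
                        ; no1-l = trans (occ-cons-≢ 1 x (Split11.left s) x≟1) no1-l ; no1-r = no1-r }
... | true with ≡ᵇ⇒≡′ x 1 x≟1
...   | refl = adjacent w (positive ∘ there) (suc-injective twice) nested
  where
  -- after the first 1, the next entry must be the second 1
  adjacent : ∀ w → (∀ {y} → y ∈ w → 1 ≤ y) → occ 1 w ≡ 1
    → all (λ y → y <ᵇ 1) (takeWhileᵇ (λ y → not (y ≡ᵇ 1)) w) ≡ true → Split11 (1 ∷ w)
  adjacent []          positive () _
  adjacent (zero ∷ w)  positive _ _ with positive (here refl)
  ... | ()
  adjacent (suc zero ∷ w) positive once _ =
    record { left = [] ; right = w ; w≡ = refl ; no1-l = refl ; no1-r = suc-injective once }
  adjacent (suc (suc y) ∷ w) positive once ()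

growStirling : List ℕ × ℕ → List ℕ
growStirling (w , g) = insert11 g (map suc w)

shrinkStirling : List ℕ → List ℕ × ℕ
shrinkStirling w = map pred (delete1s w) , index1 w

grow-isStirling : ∀ n w g → IsStirling n w → IsStirling (suc n) (growStirling (w , g))
grow-isStirling n w g s = record
  { length≡ = trans (length-insert11 g (map suc w)) (trans (cong (2 +_) (trans (length-map suc w) length≡)) (sym (*-suc 2 n)))
  ; entry   = entry′
  ; twice   = twice′
  ; nested  = nested′
  }
  where
  open IsStirling s
  no1 : occ 1 (map suc w) ≡ 0
  no1 = occ1-map-suc w positive
  entry′ : ∀ {y} → y ∈ growStirling (w , g) → 1 ≤ y × y ≤ suc n
  entry′ y∈ with ∈-insert11 g (map suc w) y∈
  ... | inj₁ refl = s≤s z≤n , s≤s z≤n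
  ... | inj₂ y∈′ with ∈-map⁻ suc y∈′
  ...   | z , z∈ , refl = s≤s z≤n , s≤s (proj₂ (entry z∈))
  twice′ : ∀ m → 1 ≤ m → m ≤ suc n → occ m (growStirling (w , g)) ≡ 2
  twice′ (suc zero)    _ _       = trans (occ1-insert11 g (map suc w)) (cong (2 +_) no1)
  twice′ (suc (suc m)) _ (s≤s m≤n) = trans (occ-insert11 m g (map suc w)) (trans (occ-map-suc (suc m) w) (twice (suc m) (s≤s z≤n) m≤n))
  nested′ : ∀ m → 1 ≤ m → m ≤ suc n → nestedAt m (growStirling (w , g)) ≡ true
  nested′ (suc zero)    _ _ rewrite between1-insert11 g (map suc w) no1 = refl
  nested′ (suc (suc m)) _ (s≤s m≤n) = trans (nestedAt-insert11 m g (map suc w)) (trans (nestedAt-map-suc (suc m) w) (nested (suc m) (s≤s z≤n) m≤n))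

shrink-grow : ∀ n w g → IsStirling n w → g ≤ 2 * n → shrinkStirling (growStirling (w , g)) ≡ (w , g)
shrink-grow n w g s g≤ = cong₂ _,_
  (trans (cong (map pred) (trans (delete1s-insert11 g (map suc w)) (delete1s-no1 (map suc w) no1))) (map-pred-suc w))
  (index1-insert11 g (map suc w) (subst (g ≤_) (sym (trans (length-map suc w) (IsStirling.length≡ s))) g≤) no1)
  where no1 = occ1-map-suc w (IsStirling.positive s)

module Shrink {n : ℕ} {w : List ℕ} (s : IsStirling (suc n) w) where
  open IsStirling s
  open Split11 (split11 w positive (twice 1 ≤-refl (s≤s z≤n)) (nested 1 ≤-refl (s≤s z≤n)))

  shrink≡ : shrinkStirling w ≡ (map pred (left ++ right) , length left)
  shrink≡ = trans (cong shrinkStirling w≡) (cong₂ _,_ (cong (map pred) (delete1s-++ left right no1-l no1-r)) (index1-++ left right no1-l))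

  ∈-w : ∀ {y} → y ∈ left ++ right → y ∈ w
  ∈-w y∈ = subst (_ ∈_) (sym w≡) (skip left y∈)
    where skip : ∀ u {y} → y ∈ u ++ right → y ∈ u ++ 1 ∷ 1 ∷ right
          skip []      y∈          = there (there y∈)
          skip (x ∷ u) (here refl) = here refl
          skip (x ∷ u) (there y∈)  = there (skip u y∈)

  grow-shrink : growStirling (shrinkStirling w) ≡ w
  grow-shrink = begin
    growStirling (shrinkStirling w)                        ≡⟨ cong growStirling shrink≡ ⟩
    insert11 (length left) (map suc (map pred (left ++ right))) ≡⟨ cong (insert11 (length left)) (map-suc-pred (left ++ right) (positive ∘ ∈-w)) ⟩
    insert11 (length left) (left ++ right)                 ≡⟨ insert11-++ left right ⟩
    left ++ 1 ∷ 1 ∷ right                                  ≡⟨ w≡ ⟨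
    w                                                      ∎
    where open ≡-Reasoning

  length-left-right : length left + length right ≡ 2 * n
  length-left-right = +-cancelˡ-≡ 2 _ _ (begin
    2 + (length left + length right)     ≡⟨ rearrange (length left) (length right) ⟩
    length left + (2 + length right)     ≡⟨ length-++ left ⟨
    length (left ++ 1 ∷ 1 ∷ right)       ≡⟨ cong length w≡ ⟨
    length w                             ≡⟨ length≡ ⟩
    2 * suc n                            ≡⟨ *-suc 2 n ⟩
    2 + 2 * n                            ∎)
    where
    open ≡-Reasoning
    rearrange : ∀ a b → 2 + (a + b) ≡ a + (2 + b)
    rearrange = solve-∀

  gap≤ : proj₂ (shrinkStirling w) ≤ 2 * n
  gap≤ = subst (_≤ 2 * n) (sym (cong proj₂ shrink≡)) (subst (length left ≤_) length-left-right (m≤m+n (length left) (length right)))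

  isStirling : IsStirling n (proj₁ (shrinkStirling w))
  isStirling = record
    { length≡ = trans (cong (length ∘ proj₁) shrink≡) (trans (length-map pred (left ++ right)) (trans (length-++ left) length-left-right))
    ; entry   = entry′
    ; twice   = twice′
    ; nested  = nested′
    }
    where
    w′ = proj₁ (shrinkStirling w)
    g′ = proj₂ (shrinkStirling w)
    entry′ : ∀ {y} → y ∈ w′ → 1 ≤ y × y ≤ n
    entry′ {y} y∈ with ∈-map⁻ pred (subst (λ p → y ∈ proj₁ p) shrink≡ y∈)
    ... | z , z∈ , refl with entry (∈-w z∈) | occ≡0⇒∉ 1 (left ++ right) (trans (occ-++ 1 left right) (cong₂ _+_ no1-l no1-r))
    ...   | 1≤z , z≤ | 1∉ with z
    ...     | suc zero      = ⊥-elim (1∉ z∈)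
    ...     | suc (suc z′)  = s≤s z≤n , ≤-pred z≤
    -- values m ≥ 1 of w′ are the values m + 1 ≥ 2 of w = insert11 g′ (map suc w′)
    twice′ : ∀ m → 1 ≤ m → m ≤ n → occ m w′ ≡ 2
    twice′ (suc m) _ m<n = begin
      occ (suc m) w′                                       ≡⟨ occ-map-suc (suc m) w′ ⟨
      occ (suc (suc m)) (map suc w′)                       ≡⟨ occ-insert11 m g′ (map suc w′) ⟨
      occ (suc (suc m)) (growStirling (shrinkStirling w))  ≡⟨ cong (occ (suc (suc m))) grow-shrink ⟩
      occ (suc (suc m)) w                                  ≡⟨ twice (suc (suc m)) (s≤s z≤n) (s≤s m<n) ⟩
      2                                                    ∎
      where open ≡-Reasoning
    nested′ : ∀ m → 1 ≤ m → m ≤ n → nestedAt m w′ ≡ true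
    nested′ (suc m) _ m<n = begin
      nestedAt (suc m) w′                                       ≡⟨ nestedAt-map-suc (suc m) w′ ⟨
      nestedAt (suc (suc m)) (map suc w′)                       ≡⟨ nestedAt-insert11 m g′ (map suc w′) ⟨
      nestedAt (suc (suc m)) (growStirling (shrinkStirling w))  ≡⟨ cong (nestedAt (suc (suc m))) grow-shrink ⟩
      nestedAt (suc (suc m)) w                                  ≡⟨ nested (suc (suc m)) (s≤s z≤n) (s≤s m<n) ⟩
      true                                                      ∎
      where open ≡-Reasoning

stirlingInsertion : ∀ n → Insertion (stirlingPerms n) (stirlingPerms (suc n)) (2 * n)
stirlingInsertion n = record
  { unique         = unique-stirlingPerms n
  ; unique'        = unique-stirlingPerms (suc n)
  ; insert         = growStirling
  ; extract        = shrinkStirling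
  ; insert∈        = λ w∈ _ → ∈-stirlingPerms⁺ (suc n) (grow-isStirling n _ _ (∈-stirlingPerms⁻ n w∈))
  ; extract∈       = λ w∈ → let s = ∈-stirlingPerms⁻ (suc n) w∈ in ∈-stirlingPerms⁺ n (Shrink.isStirling s) , Shrink.gap≤ s
  ; extract∘insert = λ w∈ g≤ → shrink-grow n _ _ (∈-stirlingPerms⁻ n w∈) g≤
  ; insert∘extract = λ w∈ → Shrink.grow-shrink (∈-stirlingPerms⁻ (suc n) w∈)
  }

E-recurrence : ∀ n j → E (suc n) j ≡ suc j * E n j + (2 * n ∸ pred j) * count (λ w → suc (ascents w) ≡ᵇ j) (stirlingPerms n)
E-recurrence n j = begin
  E (suc n) j
    ≡⟨ length-filterᵇ _ (stirlingPerms (suc n)) ⟩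
  count (λ w → ascents w ≡ᵇ j) (stirlingPerms (suc n))
    ≡⟨ insertion-recurrence (stirlingInsertion n) ascents ascents (raises ∘ map suc) suc step non-raising′ j ⟩
  suc j * count (λ w → ascents w ≡ᵇ j) (stirlingPerms n) + (2 * n ∸ pred j) * count (λ w → suc (ascents w) ≡ᵇ j) (stirlingPerms n)
    ≡⟨ cong (λ c → suc j * c + (2 * n ∸ pred j) * count (λ w → suc (ascents w) ≡ᵇ j) (stirlingPerms n)) (length-filterᵇ _ (stirlingPerms n)) ⟨
  suc j * E n j + (2 * n ∸ pred j) * count (λ w → suc (ascents w) ≡ᵇ j) (stirlingPerms n) ∎
  where
  open ≡-Reasoning
  atLeast2 : ∀ {w} → w ∈ stirlingPerms n → AtLeast2 (map suc w)
  atLeast2 w∈ y∈ with ∈-map⁻ suc y∈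
  ... | z , z∈ , refl = s≤s (IsStirling.positive (∈-stirlingPerms⁻ n w∈) z∈)
  step : ∀ {w g} → w ∈ stirlingPerms n → g ≤ 2 * n → ascents (growStirling (w , g)) ≡ 𝟙 (raises (map suc w) g) + ascents w
  step {w} {g} w∈ _ = trans (ascents-insert11 (map suc w) g (atLeast2 w∈)) (cong (𝟙 (raises (map suc w) g) +_) (ascents-map-suc w))
  non-raising′ : ∀ {w} → w ∈ stirlingPerms n → count (not ∘ raises (map suc w)) (upTo (suc (2 * n))) ≡ suc (ascents w)
  non-raising′ {w} w∈ = begin
    count (not ∘ raises (map suc w)) (upTo (suc (2 * n)))           ≡⟨ cong (λ L → count (not ∘ raises (map suc w)) (upTo (suc L))) length-suc ⟨
    count (not ∘ raises (map suc w)) (upTo (suc (length (map suc w)))) ≡⟨ non-raising (map suc w) ⟩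
    suc (ascents (map suc w))                                        ≡⟨ cong suc (ascents-map-suc w) ⟩
    suc (ascents w)                                                  ∎
    where length-suc = trans (length-map suc w) (IsStirling.length≡ (∈-stirlingPerms⁻ n w∈))

module StrictlyIncreasing (f : ℕ → ℕ) (increasing : ∀ {a x} → a < x → f a < f x) where

  ≡ᵇ-preserved : ∀ a x → (f a ≡ᵇ f x) ≡ (a ≡ᵇ x)
  ≡ᵇ-preserved a x with <-cmp a x
  ... | tri< a<x _ _ = trans (≢⇒≡ᵇ-false _ _ (<⇒≢ (increasing a<x))) (sym (≢⇒≡ᵇ-false _ _ (<⇒≢ a<x)))
  ... | tri≈ _ refl _ = trans (≡ᵇ-refl (f a)) (sym (≡ᵇ-refl a))
  ... | tri> _ _ x<a = trans (≢⇒≡ᵇ-false _ _ (<⇒≢ (increasing x<a) ∘ sym)) (sym (≢⇒≡ᵇ-false _ _ (<⇒≢ x<a ∘ sym)))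

  <ᵇ-preserved : ∀ a x → (f a <ᵇ f x) ≡ (a <ᵇ x)
  <ᵇ-preserved a x with <-cmp a x
  ... | tri< a<x _ _ = trans (<⇒<ᵇ′ (increasing a<x)) (sym (<⇒<ᵇ′ a<x))
  ... | tri≈ _ refl _ = trans (≮⇒<ᵇ-false _ _ (n≮n (f a))) (sym (≮⇒<ᵇ-false _ _ (n≮n a)))
  ... | tri> _ _ x<a = trans (≮⇒<ᵇ-false _ _ (<-asym (increasing x<a))) (sym (≮⇒<ᵇ-false _ _ (<-asym x<a)))

-- Chord diagrams.  Adding the chord {1, g + 2} to a diagram on [2n] relabels
-- the old points: 1 ≤ x ≤ g become x + 1 and x > g become x + 2.

shift : ℕ → ℕ → ℕ
shift g x = if x ≤ᵇ g then suc x else suc (suc x)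

unshift : ℕ → ℕ → ℕ
unshift g y = if y ≤ᵇ suc g then pred y else pred (pred y)

data ShiftCase (g x : ℕ) : Set where
  low  : x ≤ g → shift g x ≡ suc x → ShiftCase g x
  high : g < x → shift g x ≡ suc (suc x) → ShiftCase g x

shiftCase : ∀ g x → ShiftCase g x
shiftCase g x with x ≤? g
... | yes x≤g = low x≤g (cong (if_then suc x else suc (suc x)) (≤⇒≤ᵇ′ x≤g))
... | no x≰g  = high (≰⇒> x≰g) (cong (if_then suc x else suc (suc x)) (≰⇒≤ᵇ-false x g x≰g))

shift-≥ : ∀ g x → suc x ≤ shift g x
shift-≥ g x with shiftCase g x
... | low  _ eq = subst (suc x ≤_) (sym eq) ≤-refl
... | high _ eq = subst (suc x ≤_) (sym eq) (n≤1+n (suc x))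

shift-increasing : ∀ g {a x} → a < x → shift g a < shift g x
shift-increasing g {a} {x} a<x with shiftCase g a | shiftCase g x
... | low  _ ea | low  _ ex rewrite ea | ex = s≤s a<x
... | high _ ea | high _ ex rewrite ea | ex = s≤s (s≤s a<x)
... | low  _ ea | high _ ex rewrite ea | ex = s≤s (m≤n⇒m≤1+n a<x)
... | high g<a _ | low x≤g _ = ⊥-elim (<⇒≱ g<a (≤-trans (<⇒≤ a<x) x≤g))

open StrictlyIncreasing using (≡ᵇ-preserved; <ᵇ-preserved)

shift-≡ᵇ : ∀ g a x → (shift g a ≡ᵇ shift g x) ≡ (a ≡ᵇ x)
shift-≡ᵇ g = ≡ᵇ-preserved (shift g) (shift-increasing g)

shift-<ᵇ : ∀ g a x → (shift g a <ᵇ shift g x) ≡ (a <ᵇ x)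
shift-<ᵇ g = <ᵇ-preserved (shift g) (shift-increasing g)

shift-≢ : ∀ g x → shift g x ≢ suc (suc g)
shift-≢ g x eq with shiftCase g x
... | low  x≤g ex = <⇒≱ (s≤s ≤-refl) (subst (_≤ g) (suc-injective (trans (sym ex) eq)) x≤g)
... | high g<x ex = <-irrefl (sym (suc-injective (suc-injective (trans (sym ex) eq)))) g<x

shift-≤ : ∀ g x N → g ≤ N → x ≤ N → shift g x ≤ suc (suc N)
shift-≤ g x N g≤N x≤N with shiftCase g x
... | low  _ eq rewrite eq = s≤s (m≤n⇒m≤1+n x≤N)
... | high _ eq rewrite eq = s≤s (s≤s x≤N)

shift-≤⁻ : ∀ g x N → g ≤ N → shift g x ≤ suc (suc N) → x ≤ N
shift-≤⁻ g x N g≤N _ with shiftCase g x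
shift-≤⁻ g x N g≤N _  | low x≤g _ = ≤-trans x≤g g≤N
shift-≤⁻ g x N g≤N ≤N | high _ eq rewrite eq = ≤-pred (≤-pred ≤N)

unshift-shift : ∀ g x → unshift g (shift g x) ≡ x
unshift-shift g x with shiftCase g x
... | low x≤g eq rewrite eq | ≤⇒≤ᵇ′ (s≤s x≤g) = refl
... | high g<x eq rewrite eq | ≰⇒≤ᵇ-false (suc (suc x)) (suc g) (λ le → <⇒≱ g<x (≤-pred (≤-pred (m≤n⇒m≤1+n le)))) = refl

shift-unshift : ∀ g y → 1 ≤ y → y ≢ suc (suc g) → shift g (unshift g y) ≡ y
shift-unshift g (suc y) _ y≢ with suc y ≤? suc g
... | yes (s≤s y≤g) rewrite ≤⇒≤ᵇ′ (s≤s y≤g) with shiftCase g y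
...   | low  _ eq = eq
...   | high g<y _ = ⊥-elim (<⇒≱ g<y y≤g)
shift-unshift g (suc zero) _ y≢ | no 1≰ = ⊥-elim (1≰ (s≤s z≤n))
shift-unshift g (suc (suc y)) _ y≢ | no y≰g rewrite ≰⇒≤ᵇ-false (suc (suc y)) (suc g) y≰g with shiftCase g y
... | high _ eq = eq
... | low  y≤g _ = ⊥-elim (y≢ (cong (suc ∘ suc) (≤-antisym y≤g (≤-pred (≰⇒> (y≰g ∘ s≤s))))))

Diagram : Set
Diagram = List (ℕ × ℕ)

shiftChord : ℕ → ℕ × ℕ → ℕ × ℕ
shiftChord g (a , b) = shift g a , shift g b

unshiftChord : ℕ → ℕ × ℕ → ℕ × ℕ
unshiftChord g (a , b) = unshift g a , unshift g b

-- The diagram with the new chord {1, g + 2} first; starts stay increasing.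
addChord : ℕ → Diagram → Diagram
addChord g d = (1 , suc (suc g)) ∷ map (shiftChord g) d

growDiagram : Diagram × ℕ → Diagram
growDiagram (d , g) = addChord g d

shrinkDiagram : Diagram → Diagram × ℕ
shrinkDiagram []              = [] , 0
shrinkDiagram ((a , b) ∷ rest) = map (unshiftChord (b ∸ 2)) rest , b ∸ 2

endpointsList-map : ∀ g d → endpointsList (map (shiftChord g) d) ≡ map (shift g) (endpointsList d)
endpointsList-map g []             = refl
endpointsList-map g ((a , b) ∷ d) = cong (λ z → shift g a ∷ shift g b ∷ z) (endpointsList-map g d)

∈-endpointsList⁻ : ∀ (d : Diagram) {y} → y ∈ endpointsList d → ∃ λ p → p ∈ d × (y ≡ proj₁ p ⊎ y ≡ proj₂ p)
∈-endpointsList⁻ ((a , b) ∷ d) (here eq)         = (a , b) , here refl , inj₁ eq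
∈-endpointsList⁻ ((a , b) ∷ d) (there (here eq)) = (a , b) , here refl , inj₂ eq
∈-endpointsList⁻ ((a , b) ∷ d) (there (there y∈)) = let (p , p∈ , eq) = ∈-endpointsList⁻ d y∈ in p , there p∈ , eq

∈-endpointsList⁺₁ : ∀ (d : Diagram) {p} → p ∈ d → proj₁ p ∈ endpointsList d
∈-endpointsList⁺₁ (q ∷ d) (here refl) = here refl
∈-endpointsList⁺₁ (q ∷ d) (there p∈)  = there (there (∈-endpointsList⁺₁ d p∈))

∈-endpointsList⁺₂ : ∀ (d : Diagram) {p} → p ∈ d → proj₂ p ∈ endpointsList d
∈-endpointsList⁺₂ (q ∷ d) (here refl) = there (here refl)
∈-endpointsList⁺₂ (q ∷ d) (there p∈)  = there (there (∈-endpointsList⁺₂ d p∈))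

occ-map-shift : ∀ g x ps → occ (shift g x) (map (shift g) ps) ≡ occ x ps
occ-map-shift g x []       = refl
occ-map-shift g x (y ∷ ps) rewrite shift-≡ᵇ g x y with x ≡ᵇ y
... | true  = cong suc (occ-map-shift g x ps)
... | false = occ-map-shift g x ps

startsIncreasing-map : ∀ g d → startsIncreasing (map (shiftChord g) d) ≡ startsIncreasing d
startsIncreasing-map g []                        = refl
startsIncreasing-map g (p ∷ [])                  = refl
startsIncreasing-map g ((a , b) ∷ (c , e) ∷ d) = cong₂ _∧_ (shift-<ᵇ g a c) (startsIncreasing-map g ((c , e) ∷ d))

ordered : Diagram → Bool
ordered = all (λ p → proj₁ p <ᵇ proj₂ p)

ordered-map : ∀ g d → ordered (map (shiftChord g) d) ≡ ordered d
ordered-map g []             = refl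
ordered-map g ((a , b) ∷ d) = cong₂ _∧_ (shift-<ᵇ g a b) (ordered-map g d)

startsIncreasing-tail : ∀ p d → startsIncreasing (p ∷ d) ≡ true → startsIncreasing d ≡ true
startsIncreasing-tail p []      _  = refl
startsIncreasing-tail p (q ∷ d) si = proj₂ (∧-true⁻ {proj₁ p <ᵇ proj₁ q} si)

startsIncreasing-head : ∀ q d {p} → startsIncreasing (q ∷ d) ≡ true → p ∈ q ∷ d → proj₁ q ≤ proj₁ p
startsIncreasing-head q d        si (here refl) = ≤-refl
startsIncreasing-head q (q′ ∷ d) si (there p∈) =
  let (q<q′ , si′) = ∧-true⁻ {proj₁ q <ᵇ proj₁ q′} si
  in ≤-trans (<⇒≤ (<ᵇ⇒<′ _ _ q<q′)) (startsIncreasing-head q′ d si′ p∈)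

record IsDiagram (n : ℕ) (d : Diagram) : Set where
  field
    length≡    : length d ≡ n
    points     : ∀ {p} → p ∈ d → (1 ≤ proj₁ p × proj₁ p ≤ 2 * n) × (1 ≤ proj₂ p × proj₂ p ≤ 2 * n)
    ordered≡   : ordered d ≡ true
    increasing : startsIncreasing d ≡ true
    once       : ∀ i → 1 ≤ i → i ≤ 2 * n → occ i (endpointsList d) ≡ 1

  positive : ∀ {y} → y ∈ endpointsList d → 1 ≤ y
  positive y∈ with ∈-endpointsList⁻ d y∈
  ... | p , p∈ , inj₁ refl = proj₁ (proj₁ (points p∈))
  ... | p , p∈ , inj₂ refl = proj₁ (proj₂ (points p∈))

pairs≡ : ∀ n → pairs n ≡ cartesianProduct (range 1 (2 * n)) (range 1 (2 * n))
pairs≡ n = concatMap-map _,_ (range 1 (2 * n)) (range 1 (2 * n))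

∈-chordDiagrams⁻ : ∀ n {d} → d ∈ chordDiagrams n → IsDiagram n d
∈-chordDiagrams⁻ n {d} d∈ = record
  { length≡    = proj₁ (∈-words⁻ n (pairs n) d∈words)
  ; points     = points
  ; ordered≡   = proj₁ tests
  ; increasing = proj₁ (∧-true⁻ {startsIncreasing d} (proj₂ tests))
  ; once       = λ i 1≤i i≤ → ≡ᵇ⇒≡′ _ _ (all-true⁻ _ (range 1 (2 * n)) once-test (∈-range⁺ 1 (2 * n) 1≤i (s≤s i≤)))
  }
  where
  d∈words = proj₁ (∈-filterᵇ⁻ _ (words n (pairs n)) d∈)
  tests   = ∧-true⁻ (proj₂ (∈-filterᵇ⁻ _ (words n (pairs n)) d∈))
  once-test = proj₂ (∧-true⁻ {startsIncreasing d} (proj₂ tests))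
  points : ∀ {p} → p ∈ d → (1 ≤ proj₁ p × proj₁ p ≤ 2 * n) × (1 ≤ proj₂ p × proj₂ p ≤ 2 * n)
  points {p} p∈ =
    let p∈pairs   = subst (p ∈_) (pairs≡ n) (proj₂ (∈-words⁻ n (pairs n) d∈words) p∈)
        (a∈ , b∈) = ∈-cartesianProduct⁻ (range 1 (2 * n)) (range 1 (2 * n)) p∈pairs
        (1≤a , a<) = ∈-range⁻ 1 (2 * n) a∈
        (1≤b , b<) = ∈-range⁻ 1 (2 * n) b∈
    in (1≤a , ≤-pred a<) , (1≤b , ≤-pred b<)

∈-chordDiagrams⁺ : ∀ n {d} → IsDiagram n d → d ∈ chordDiagrams n
∈-chordDiagrams⁺ n {d} D = ∈-filterᵇ⁺ _ (words n (pairs n))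
  (subst (λ L → d ∈ words L (pairs n)) length≡ (∈-words⁺ (pairs n) d λ {p} p∈ →
    let ((1≤a , a≤) , (1≤b , b≤)) = points p∈ in
    subst (p ∈_) (sym (pairs≡ n)) (∈-cartesianProduct⁺ (∈-range⁺ 1 (2 * n) 1≤a (s≤s a≤)) (∈-range⁺ 1 (2 * n) 1≤b (s≤s b≤)))))
  (∧-true⁺ ordered≡ (∧-true⁺ increasing (all-true⁺ _ (range 1 (2 * n)) λ i∈ →
    let (1≤i , i<) = ∈-range⁻ 1 (2 * n) i∈ in ≡⇒≡ᵇ′ _ _ (once _ 1≤i (≤-pred i<)))))
  where open IsDiagram D

unique-chordDiagrams : ∀ n → Unique (chordDiagrams n)
unique-chordDiagrams n = Unique.filter⁺ _ (unique-words n unique-pairs)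
  where unique-pairs = subst Unique (sym (pairs≡ n)) (Unique.cartesianProduct⁺ (unique-range 1 (2 * n)) (unique-range 1 (2 * n)))

endpoints-addChord : ∀ g d → endpointsList (addChord g d) ≡ 1 ∷ suc (suc g) ∷ map (shift g) (endpointsList d)
endpoints-addChord g d = cong (λ z → 1 ∷ suc (suc g) ∷ z) (endpointsList-map g d)

shift-≥2 : ∀ g x → 1 ≤ x → 2 ≤ shift g x
shift-≥2 g x 1≤x = ≤-trans (s≤s 1≤x) (shift-≥ g x)

occ-addChord-shift : ∀ g x ps → 1 ≤ x → occ (shift g x) (1 ∷ suc (suc g) ∷ map (shift g) ps) ≡ occ x ps
occ-addChord-shift g x ps 1≤x
  rewrite ≢⇒≡ᵇ-false (shift g x) 1 (λ eq → <⇒≱ (shift-≥2 g x 1≤x) (subst (_≤ 1) (sym eq) ≤-refl))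
        | ≢⇒≡ᵇ-false (shift g x) (suc (suc g)) (shift-≢ g x) = occ-map-shift g x ps

occ-addChord-new : ∀ g ps → occ (suc (suc g)) (1 ∷ suc (suc g) ∷ ps) ≡ suc (occ (suc (suc g)) ps)
occ-addChord-new g ps rewrite ≡ᵇ-refl g = refl

grow-isDiagram : ∀ n d g → IsDiagram n d → g ≤ 2 * n → IsDiagram (suc n) (addChord g d)
grow-isDiagram n d g D g≤ = record
  { length≡    = cong suc (trans (length-map (shiftChord g) d) length≡)
  ; points     = points′
  ; ordered≡   = trans (ordered-map g d) ordered≡
  ; increasing = increasing′ d (λ p∈ → proj₁ (proj₁ (points p∈))) increasing
  ; once       = once′
  }
  where
  open IsDiagram D
  2n+2 = *-suc 2 n
  inRange : ∀ x → 1 ≤ x → x ≤ 2 * n → 1 ≤ shift g x × shift g x ≤ 2 * suc n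
  inRange x 1≤x x≤ = ≤-trans (s≤s z≤n) (shift-≥ g x) , subst (shift g x ≤_) (sym 2n+2) (shift-≤ g x (2 * n) g≤ x≤)
  points′ : ∀ {p} → p ∈ addChord g d → (1 ≤ proj₁ p × proj₁ p ≤ 2 * suc n) × (1 ≤ proj₂ p × proj₂ p ≤ 2 * suc n)
  points′ (here refl) = (s≤s z≤n , subst (1 ≤_) (sym 2n+2) (s≤s z≤n)) , (s≤s z≤n , subst (suc (suc g) ≤_) (sym 2n+2) (s≤s (s≤s g≤)))
  points′ (there p∈) with ∈-map⁻ (shiftChord g) p∈
  ... | q , q∈ , refl = let ((1≤a , a≤) , (1≤b , b≤)) = points q∈ in inRange _ 1≤a a≤ , inRange _ 1≤b b≤
  increasing′ : ∀ d → (∀ {p} → p ∈ d → 1 ≤ proj₁ p) → startsIncreasing d ≡ true → startsIncreasing (addChord g d) ≡ true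
  increasing′ []      _ _  = refl
  increasing′ (q ∷ d) 1≤ si = ∧-true⁺ (<⇒<ᵇ′ (shift-≥2 g _ (1≤ (here refl)))) (trans (startsIncreasing-map g (q ∷ d)) si)
  old = map (shift g) (endpointsList d)
  once-new : ∀ i → 1 ≤ i → i ≤ 2 * suc n → occ i (1 ∷ suc (suc g) ∷ old) ≡ 1
  once-new i 1≤i i≤ with i ≟ 1 | i ≟ suc (suc g)
  ... | yes refl | _ = cong suc (∉⇒occ≡0 1 old λ y∈ y≡1 → case y∈ y≡1)
    where
    case : ∀ {y} → y ∈ old → y ≡ 1 → ⊥
    case y∈ y≡1 with ∈-map⁻ (shift g) y∈
    ... | x , x∈ , refl = <⇒≱ (shift-≥2 g x (positive x∈)) (subst (_≤ 1) (sym y≡1) ≤-refl)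
  ... | no _ | yes refl = trans (occ-addChord-new g old) (cong suc (∉⇒occ≡0 _ old λ y∈ y≡ → case y∈ y≡))
    where
    case : ∀ {y} → y ∈ old → y ≡ suc (suc g) → ⊥
    case y∈ y≡ with ∈-map⁻ (shift g) y∈
    ... | x , _ , refl = shift-≢ g x y≡
  ... | no i≢1 | no i≢g+2 = begin
    occ i (1 ∷ suc (suc g) ∷ old)            ≡⟨ cong (λ z → occ z (1 ∷ suc (suc g) ∷ old)) (shift-unshift g i 1≤i i≢g+2) ⟨
    occ (shift g x) (1 ∷ suc (suc g) ∷ old)  ≡⟨ occ-addChord-shift g x (endpointsList d) 1≤x ⟩
    occ x (endpointsList d)                  ≡⟨ once x 1≤x x≤ ⟩
    1                                        ∎
    where
    open ≡-Reasoning
    x = unshift g i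
    1≤x : 1 ≤ x
    1≤x with x | shift-unshift g i 1≤i i≢g+2
    ... | zero  | eq = ⊥-elim (i≢1 (sym eq))
    ... | suc _ | _  = s≤s z≤n
    x≤ : x ≤ 2 * n
    x≤ = shift-≤⁻ g x (2 * n) g≤ (subst (_≤ suc (suc (2 * n))) (sym (shift-unshift g i 1≤i i≢g+2)) (subst (i ≤_) 2n+2 i≤))
  once′ : ∀ i → 1 ≤ i → i ≤ 2 * suc n → occ i (endpointsList (addChord g d)) ≡ 1
  once′ i 1≤i i≤ = trans (cong (occ i) (endpoints-addChord g d)) (once-new i 1≤i i≤)

isDiagram-of-grown : ∀ n d g → g ≤ 2 * n → IsDiagram (suc n) (addChord g d) → IsDiagram n d
isDiagram-of-grown n d g g≤ D = record
  { length≡    = suc-injective (trans (cong suc (sym (length-map (shiftChord g) d))) length≡)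
  ; points     = points′
  ; ordered≡   = trans (sym (ordered-map g d)) ordered≡
  ; increasing = trans (sym (startsIncreasing-map g d)) (startsIncreasing-tail _ (map (shiftChord g) d) increasing)
  ; once       = once′
  }
  where
  open IsDiagram D
  2n+2 = *-suc 2 n
  ps = endpointsList d
  new≡ : endpointsList (addChord g d) ≡ 1 ∷ suc (suc g) ∷ map (shift g) ps
  new≡ = endpoints-addChord g d
  no0 : occ 0 ps ≡ 0
  no0 = suc-injective (trans (sym (cong suc (occ-map-shift g 0 ps))) (trans (cong (occ 1) (sym new≡)) (once 1 ≤-refl (subst (1 ≤_) (sym 2n+2) (s≤s z≤n)))))
  once′ : ∀ x → 1 ≤ x → x ≤ 2 * n → occ x ps ≡ 1
  once′ x 1≤x x≤ = trans (sym (occ-addChord-shift g x ps 1≤x)) (trans (cong (occ (shift g x)) (sym new≡))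
    (once (shift g x) (≤-trans (s≤s z≤n) (shift-≥ g x)) (subst (shift g x ≤_) (sym 2n+2) (shift-≤ g x (2 * n) g≤ x≤))))
  inRange : ∀ x → x ∈ ps → shift g x ≤ 2 * suc n → 1 ≤ x × x ≤ 2 * n
  inRange zero    x∈ _ = ⊥-elim (occ≡0⇒∉ 0 ps no0 x∈)
  inRange (suc x) x∈ ≤ = s≤s z≤n , shift-≤⁻ g (suc x) (2 * n) g≤ (subst (shift g (suc x) ≤_) 2n+2 ≤)
  points′ : ∀ {p} → p ∈ d → (1 ≤ proj₁ p × proj₁ p ≤ 2 * n) × (1 ≤ proj₂ p × proj₂ p ≤ 2 * n)
  points′ p∈ = let ((_ , a≤) , (_ , b≤)) = points (there (∈-map⁺ (shiftChord g) p∈)) in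
    inRange _ (∈-endpointsList⁺₁ d p∈) a≤ , inRange _ (∈-endpointsList⁺₂ d p∈) b≤

record FirstChord (n : ℕ) (ps : Diagram) : Set where
  field
    gap   : ℕ
    rest  : Diagram
    ps≡   : ps ≡ (1 , suc (suc gap)) ∷ rest
    gap≤  : gap ≤ 2 * n

firstChord : ∀ n ps → IsDiagram (suc n) ps → FirstChord n ps
firstChord n []              D with IsDiagram.length≡ D
... | ()
firstChord n ((a , b) ∷ rest) D with a≡1 | a<b
  where
  open IsDiagram D
  1≤a : 1 ≤ a
  1≤a = proj₁ (proj₁ (points (here refl)))
  1∈ : 1 ∈ endpointsList ((a , b) ∷ rest)
  1∈ = occ≢0⇒∈ 1 _ λ occ≡0 → 1+n≢0 (trans (sym (once 1 ≤-refl (subst (1 ≤_) (sym (*-suc 2 n)) (s≤s z≤n)))) occ≡0)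
  -- the point 1 cannot be an endpoint, so it is the smallest startpoint
  a≤1 : a ≤ 1
  a≤1 with ∈-endpointsList⁻ _ 1∈
  ... | p , p∈ , inj₁ 1≡start = subst (a ≤_) (sym 1≡start) (startsIncreasing-head (a , b) rest increasing p∈)
  ... | p , p∈ , inj₂ 1≡end   = ⊥-elim (<⇒≱ (subst (proj₁ p <_) (sym 1≡end) (<ᵇ⇒<′ _ _ (all-true⁻ _ _ ordered≡ p∈))) (proj₁ (proj₁ (points p∈))))
  a≡1 : a ≡ 1
  a≡1 = ≤-antisym a≤1 1≤a
  a<b : a < b
  a<b = <ᵇ⇒<′ a b (proj₁ (∧-true⁻ {a <ᵇ b} ordered≡))
... | refl | s≤s (s≤s {n = g} z≤n) = record
  { gap = g ; rest = rest ; ps≡ = refl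
  ; gap≤ = ≤-pred (≤-pred (subst (suc (suc g) ≤_) (*-suc 2 n) (proj₂ (proj₂ (IsDiagram.points D (here refl)))))) }

shrink-grow-diagram : ∀ g d → shrinkDiagram (growDiagram (d , g)) ≡ (d , g)
shrink-grow-diagram g d = cong (_, g) (unshift-map d)
  where unshift-map : ∀ d → map (unshiftChord g) (map (shiftChord g) d) ≡ d
        unshift-map []             = refl
        unshift-map ((a , b) ∷ d) = cong₂ _∷_ (cong₂ _,_ (unshift-shift g a) (unshift-shift g b)) (unshift-map d)

module ShrinkDiagram {n : ℕ} {ps : Diagram} (D : IsDiagram (suc n) ps) where
  open FirstChord (firstChord n ps D)
  private
    D′ : IsDiagram (suc n) ((1 , suc (suc gap)) ∷ rest)
    D′ = subst (IsDiagram (suc n)) ps≡ D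

    no-gap+2 : occ (suc (suc gap)) (endpointsList rest) ≡ 0
    no-gap+2 = suc-injective (trans (sym (occ-addChord-new gap (endpointsList rest)))
      (IsDiagram.once D′ (suc (suc gap)) (s≤s z≤n) (subst (suc (suc gap) ≤_) (sym (*-suc 2 n)) (s≤s (s≤s gap≤)))))

    shift-unshift-map : ∀ qs → (∀ {y} → y ∈ endpointsList qs → 1 ≤ y × y ≢ suc (suc gap))
      → map (shiftChord gap) (map (unshiftChord gap) qs) ≡ qs
    shift-unshift-map []             _ = refl
    shift-unshift-map ((a , b) ∷ qs) h =
      let (1≤a , a≢) = h (here refl)
          (1≤b , b≢) = h (there (here refl))
      in cong₂ _∷_ (cong₂ _,_ (shift-unshift gap a 1≤a a≢) (shift-unshift gap b 1≤b b≢)) (shift-unshift-map qs (h ∘ there ∘ there))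

  gap≤′ : proj₂ (shrinkDiagram ps) ≤ 2 * n
  gap≤′ = subst (λ qs → proj₂ (shrinkDiagram qs) ≤ 2 * n) (sym ps≡) gap≤

  grow-shrink : growDiagram (shrinkDiagram ps) ≡ ps
  grow-shrink = subst (λ qs → growDiagram (shrinkDiagram qs) ≡ qs) (sym ps≡)
    (cong ((1 , suc (suc gap)) ∷_) (shift-unshift-map rest λ y∈ →
      IsDiagram.positive D′ (there (there y∈)) , λ { refl → occ≡0⇒∉ _ (endpointsList rest) no-gap+2 y∈ }))

  isDiagram : IsDiagram n (proj₁ (shrinkDiagram ps))
  isDiagram = isDiagram-of-grown n _ _ gap≤′ (subst (IsDiagram (suc n)) (sym grow-shrink) D)

-- LR pairs are read off the words of start- and endpoint indicators.

interval : ℕ → ℕ → List ℕ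
interval a zero    = []
interval a (suc L) = a ∷ interval (suc a) L

range≡interval : ∀ a L → range a L ≡ interval a L
range≡interval a L = trans (map-upTo (a +_) L) (go (a +_) a L (λ _ → refl))
  where go : ∀ (f : ℕ → ℕ) a L → (∀ i → f i ≡ a + i) → applyUpTo f L ≡ interval a L
        go f a zero    _ = refl
        go f a (suc L) h = cong₂ _∷_ (trans (h 0) (+-identityʳ a)) (go (f ∘ suc) (suc a) L (λ i → trans (h (suc i)) (+-suc a i)))

length-interval : ∀ a L → length (interval a L) ≡ L
length-interval a zero    = refl
length-interval a (suc L) = cong suc (length-interval (suc a) L)

startWord endWord : ℕ → Diagram → List Bool
startWord n d = map (isStartpoint d) (interval 1 (2 * n))
endWord   n d = map (isEndpoint d)   (interval 1 (2 * n))

adjacentPairs : List Bool → List Bool → ℕ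
adjacentPairs (x ∷ x′ ∷ xs) (y ∷ y′ ∷ ys) = 𝟙 (x ∧ y′) + adjacentPairs (x′ ∷ xs) (y′ ∷ ys)
adjacentPairs _             _             = 0

adjacentPairs-interval : ∀ (f h : ℕ → Bool) a L
  → count (λ i → f i ∧ h (suc i)) (interval a (L ∸ 1)) ≡ adjacentPairs (map f (interval a L)) (map h (interval a L))
adjacentPairs-interval f h a zero          = refl
adjacentPairs-interval f h a (suc zero)    = refl
adjacentPairs-interval f h a (suc (suc L)) = cong (𝟙 (f a ∧ h (suc a)) +_) (adjacentPairs-interval f h (suc a) (suc L))

lrPairs-words : ∀ n d → lrPairs n d ≡ adjacentPairs (startWord n d) (endWord n d)
lrPairs-words n d = begin
  lrPairs n d                                                          ≡⟨ length-filterᵇ _ (range 1 (2 * n ∸ 1)) ⟩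
  count (λ i → isStartpoint d i ∧ isEndpoint d (suc i)) (range 1 (2 * n ∸ 1))    ≡⟨ cong (count _) (range≡interval 1 (2 * n ∸ 1)) ⟩
  count (λ i → isStartpoint d i ∧ isEndpoint d (suc i)) (interval 1 (2 * n ∸ 1)) ≡⟨ adjacentPairs-interval (isStartpoint d) (isEndpoint d) 1 (2 * n) ⟩
  adjacentPairs (startWord n d) (endWord n d)                          ∎
  where open ≡-Reasoning

descents : List Bool → ℕ
descents (x ∷ y ∷ t) = 𝟙 (x ∧ not y) + descents (y ∷ t)
descents _           = 0

adjacentPairs-not : ∀ t → adjacentPairs t (map not t) ≡ descents t
adjacentPairs-not []          = refl
adjacentPairs-not (x ∷ [])    = refl
adjacentPairs-not (x ∷ y ∷ t) = cong (𝟙 (x ∧ not y) +_) (adjacentPairs-not (y ∷ t))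

-- Inserting a letter into gap g of a word (any g ≥ length t is the end).
insertAt : ℕ → Bool → List Bool → List Bool
insertAt zero    b t       = b ∷ t
insertAt (suc g) b []      = b ∷ []
insertAt (suc g) b (x ∷ t) = x ∷ insertAt g b t

insertAt-[] : ∀ g b → insertAt g b [] ≡ b ∷ []
insertAt-[] zero    b = refl
insertAt-[] (suc g) b = refl

map-interval-insertAt : ∀ (F f : ℕ → Bool) (b : Bool) a L g → g ≤ L
  → (∀ x → a ≤ x → x < a + g → F (suc x) ≡ f x)
  → F (suc (a + g)) ≡ b
  → (∀ x → a + g ≤ x → F (suc (suc x)) ≡ f x)
  → map F (interval (suc a) (suc L)) ≡ insertAt g b (map f (interval a L))
map-interval-insertAt F f b a L zero _ below at above =
  cong₂ _∷_ (subst (λ z → F (suc z) ≡ b) (+-identityʳ a) at) (shifted-by-two a L (λ x a≤x → above x (subst (_≤ x) (sym (+-identityʳ a)) a≤x)))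
  where shifted-by-two : ∀ a L → (∀ x → a ≤ x → F (suc (suc x)) ≡ f x) → map F (interval (suc (suc a)) L) ≡ map f (interval a L)
        shifted-by-two a zero    h = refl
        shifted-by-two a (suc L) h = cong₂ _∷_ (h a ≤-refl) (shifted-by-two (suc a) L (λ x a<x → h x (<⇒≤ a<x)))
map-interval-insertAt F f b a (suc L) (suc g) (s≤s g≤L) below at above =
  cong₂ _∷_ (below a ≤-refl (subst (a <_) (sym (+-suc a g)) (s≤s (m≤m+n a g))))
    (map-interval-insertAt F f b (suc a) L g g≤L
      (λ x a<x x< → below x (<⇒≤ a<x) (subst (x <_) (sym (+-suc a g)) x<))
      (subst (λ z → F (suc z) ≡ b) (+-suc a g) at)
      (λ x ≤x → above x (subst (_≤ x) (sym (+-suc a g)) ≤x)))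

any-map : {A B : Set} (p : B → Bool) (f : A → B) (xs : List A) → any p (map f xs) ≡ any (p ∘ f) xs
any-map p f xs = cong or (sym (map-∘ xs))

any-cong : {A : Set} (p q : A → Bool) (xs : List A) → (∀ x → p x ≡ q x) → any p xs ≡ any q xs
any-cong p q xs p≗q = cong or (map-cong p≗q xs)

any-false : {A : Set} (p : A → Bool) (xs : List A) → (∀ {x} → x ∈ xs → p x ≡ false) → any p xs ≡ false
any-false p []       _ = refl
any-false p (x ∷ xs) h rewrite h (here refl) = any-false p xs (h ∘ there)

isStartpoint-shift : ∀ g d x → 1 ≤ x → isStartpoint (addChord g d) (shift g x) ≡ isStartpoint d x
isStartpoint-shift g d x 1≤x
  rewrite ≢⇒≡ᵇ-false 1 (shift g x) (λ eq → <⇒≱ (shift-≥2 g x 1≤x) (subst (_≤ 1) eq ≤-refl)) =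
  trans (any-map (λ p → proj₁ p ≡ᵇ shift g x) (shiftChord g) d) (any-cong _ _ d (λ q → shift-≡ᵇ g (proj₁ q) x))

isStartpoint-new : ∀ g d → isStartpoint (addChord g d) (suc (suc g)) ≡ false
isStartpoint-new g d = trans (any-map (λ p → proj₁ p ≡ᵇ suc (suc g)) (shiftChord g) d)
  (any-false _ d (λ {q} _ → ≢⇒≡ᵇ-false _ _ (shift-≢ g (proj₁ q))))

isEndpoint-shift : ∀ g d x → isEndpoint (addChord g d) (shift g x) ≡ isEndpoint d x
isEndpoint-shift g d x rewrite ≡ᵇ-sym (suc (suc g)) (shift g x) | ≢⇒≡ᵇ-false _ _ (shift-≢ g x) =
  trans (any-map (λ p → proj₂ p ≡ᵇ shift g x) (shiftChord g) d) (any-cong _ _ d (λ q → shift-≡ᵇ g (proj₂ q) x))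

isEndpoint-new : ∀ g d → isEndpoint (addChord g d) (suc (suc g)) ≡ true
isEndpoint-new g d rewrite ≡ᵇ-refl g = refl

isEndpoint-1 : ∀ g d → (∀ {q} → q ∈ d → 1 ≤ proj₂ q) → isEndpoint (addChord g d) 1 ≡ false
isEndpoint-1 g d 1≤ = trans (any-map (λ p → proj₂ p ≡ᵇ 1) (shiftChord g) d)
  (any-false _ d (λ q∈ → ≢⇒≡ᵇ-false _ 1 (λ eq → <⇒≱ (shift-≥2 g _ (1≤ q∈)) (subst (_≤ 1) (sym eq) ≤-refl))))

word-addChord : ∀ (F f : ℕ → Bool) (b : Bool) n g → g ≤ 2 * n
  → (∀ x → 1 ≤ x → F (shift g x) ≡ f x) → F (suc (suc g)) ≡ b
  → map F (interval 2 (suc (2 * n))) ≡ insertAt g b (map f (interval 1 (2 * n)))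
word-addChord F f b n g g≤ F∘shift F-new = map-interval-insertAt F f b 1 (2 * n) g g≤
  (λ x 1≤x x<1+g → trans (cong F (sym (low-shift x (≤-pred x<1+g)))) (F∘shift x 1≤x))
  F-new
  (λ x 1+g≤x → trans (cong F (sym (high-shift x 1+g≤x))) (F∘shift x (≤-trans (s≤s z≤n) 1+g≤x)))
  where
  low-shift : ∀ x → x ≤ g → shift g x ≡ suc x
  low-shift x x≤g with shiftCase g x
  ... | low  _ eq   = eq
  ... | high g<x _  = ⊥-elim (<⇒≱ g<x x≤g)
  high-shift : ∀ x → g < x → shift g x ≡ suc (suc x)
  high-shift x g<x with shiftCase g x
  ... | high _ eq  = eq
  ... | low  x≤g _ = ⊥-elim (<⇒≱ g<x x≤g)

startWord-addChord : ∀ n g d → g ≤ 2 * n → startWord (suc n) (addChord g d) ≡ true ∷ insertAt g false (startWord n d)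
startWord-addChord n g d g≤ = trans (cong (λ L → map (isStartpoint (addChord g d)) (interval 1 L)) (*-suc 2 n))
  (cong (true ∷_) (word-addChord (isStartpoint (addChord g d)) (isStartpoint d) false n g g≤ (isStartpoint-shift g d) (isStartpoint-new g d)))

endWord-addChord : ∀ n g d → g ≤ 2 * n → (∀ {q} → q ∈ d → 1 ≤ proj₂ q) → endWord (suc n) (addChord g d) ≡ false ∷ insertAt g true (endWord n d)
endWord-addChord n g d g≤ 1≤ = trans (cong (λ L → map (isEndpoint (addChord g d)) (interval 1 L)) (*-suc 2 n))
  (cong₂ _∷_ (isEndpoint-1 g d 1≤) (word-addChord (isEndpoint (addChord g d)) (isEndpoint d) true n g g≤ (λ x _ → isEndpoint-shift g d x) (isEndpoint-new g d)))

descentRises : Bool → List Bool → ℕ → Bool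
descentRises x []      g       = x
descentRises x (y ∷ t) zero    = x ∧ y
descentRises x (y ∷ t) (suc g) = descentRises y t g

descents-insertAt : ∀ x t g → descents (x ∷ insertAt g false t) ≡ 𝟙 (descentRises x t g) + descents (x ∷ t)
descents-insertAt x []      g rewrite insertAt-[] g false with x
... | true  = refl
... | false = refl
descents-insertAt x (y ∷ t) zero with x | y
... | true  | true  = refl
... | true  | false = refl
... | false | _     = refl
descents-insertAt x (y ∷ t) (suc g) = begin
  𝟙 (x ∧ not y) + descents (y ∷ insertAt g false t)                 ≡⟨ cong (𝟙 (x ∧ not y) +_) (descents-insertAt y t g) ⟩
  𝟙 (x ∧ not y) + (𝟙 (descentRises y t g) + descents (y ∷ t))      ≡⟨ +-comm-left (𝟙 (x ∧ not y)) (𝟙 (descentRises y t g)) (descents (y ∷ t)) ⟩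
  𝟙 (descentRises y t g) + (𝟙 (x ∧ not y) + descents (y ∷ t))      ∎
  where
  open ≡-Reasoning
  +-comm-left : ∀ a b c → a + (b + c) ≡ b + (a + c)
  +-comm-left = solve-∀

trues : List Bool → ℕ
trues = count (λ b → b)

non-rising-descents : ∀ x t → count (not ∘ descentRises x t) (upTo (suc (length t))) + trues (x ∷ t) ≡ suc (length t) + descents (x ∷ t)
non-rising-descents true  []      = refl
non-rising-descents false []      = refl
non-rising-descents x     (y ∷ t) = begin
  count (not ∘ descentRises x (y ∷ t)) (upTo (suc (suc (length t)))) + trues (x ∷ y ∷ t)
    ≡⟨ cong (_+ trues (x ∷ y ∷ t)) (count-upTo-suc (not ∘ descentRises x (y ∷ t)) (suc (length t))) ⟩
  (𝟙 (not (x ∧ y)) + rest) + (𝟙 x + trues (y ∷ t))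
    ≡⟨ regroup (𝟙 (not (x ∧ y))) rest (𝟙 x) (trues (y ∷ t)) ⟩
  (𝟙 (not (x ∧ y)) + 𝟙 x) + (rest + trues (y ∷ t))
    ≡⟨ cong ((𝟙 (not (x ∧ y)) + 𝟙 x) +_) (non-rising-descents y t) ⟩
  (𝟙 (not (x ∧ y)) + 𝟙 x) + (suc (length t) + descents (y ∷ t))
    ≡⟨ letters x y (length t) (descents (y ∷ t)) ⟩
  suc (suc (length t)) + (𝟙 (x ∧ not y) + descents (y ∷ t)) ∎
  where
  open ≡-Reasoning
  rest = count (not ∘ descentRises y t) (upTo (suc (length t)))
  regroup : ∀ a b c e → (a + b) + (c + e) ≡ (a + c) + (b + e)
  regroup = solve-∀
  letters : ∀ x y L c → (𝟙 (not (x ∧ y)) + 𝟙 x) + (suc L + c) ≡ suc (suc L) + (𝟙 (x ∧ not y) + c)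
  letters true  true  L c = refl
  letters true  false L c = cong (suc ∘ suc) (sym (+-suc L c))
  letters false y     L c = refl

StartsWithTrue : List Bool → Set
StartsWithTrue []      = ⊤
StartsWithTrue (x ∷ _) = x ≡ true

record Balanced (n : ℕ) (d : Diagram) : Set where
  field
    complement : endWord n d ≡ map not (startWord n d)
    starts     : trues (startWord n d) ≡ n
    first      : StartsWithTrue (startWord n d)

map-not-insertAt : ∀ g b t → map not (insertAt g b t) ≡ insertAt g (not b) (map not t)
map-not-insertAt zero    b t       = refl
map-not-insertAt (suc g) b []      = refl
map-not-insertAt (suc g) b (x ∷ t) = cong (not x ∷_) (map-not-insertAt g b t)

trues-insertAt-false : ∀ g t → trues (insertAt g false t) ≡ trues t
trues-insertAt-false zero    t       = refl
trues-insertAt-false (suc g) []      = refl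
trues-insertAt-false (suc g) (x ∷ t) = cong (𝟙 x +_) (trues-insertAt-false g t)

balanced-addChord : ∀ n g d → g ≤ 2 * n → IsDiagram n d → Balanced n d → Balanced (suc n) (addChord g d)
balanced-addChord n g d g≤ D B = record
  { complement = begin
      endWord (suc n) (addChord g d)                     ≡⟨ endWord-addChord n g d g≤ (λ q∈ → proj₁ (proj₂ (IsDiagram.points D q∈))) ⟩
      false ∷ insertAt g true (endWord n d)              ≡⟨ cong (λ t → false ∷ insertAt g true t) complement ⟩
      false ∷ insertAt g true (map not (startWord n d))  ≡⟨ cong (false ∷_) (map-not-insertAt g false (startWord n d)) ⟨
      map not (true ∷ insertAt g false (startWord n d))  ≡⟨ cong (map not) (startWord-addChord n g d g≤) ⟨
      map not (startWord (suc n) (addChord g d))         ∎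
  ; starts = trans (cong trues (startWord-addChord n g d g≤)) (cong suc (trans (trues-insertAt-false g (startWord n d)) starts))
  ; first  = subst StartsWithTrue (sym (startWord-addChord n g d g≤)) refl
  }
  where
  open ≡-Reasoning
  open Balanced B

-- By induction on n: every diagram arises by adding a chord to a smaller one.
balanced : ∀ n d → IsDiagram n d → Balanced n d
balanced zero    d D = record { complement = refl ; starts = refl ; first = tt }
balanced (suc n) d D = subst (Balanced (suc n)) grow-shrink
  (balanced-addChord n _ _ gap≤′ isDiagram (balanced n _ isDiagram))
  where open ShrinkDiagram D

lrPairs-descents : ∀ n d → Balanced n d → lrPairs n d ≡ descents (startWord n d)
lrPairs-descents n d B = trans (lrPairs-words n d) (trans (cong (adjacentPairs (startWord n d)) (Balanced.complement B)) (adjacentPairs-not (startWord n d)))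

descents-true : ∀ t → StartsWithTrue t → descents (true ∷ t) ≡ descents t
descents-true []       _    = refl
descents-true (true ∷ t) refl = refl

lrPairs-addChord : ∀ n g d → g ≤ 2 * n → IsDiagram n d
  → lrPairs (suc n) (addChord g d) ≡ 𝟙 (descentRises true (startWord n d) g) + lrPairs n d
lrPairs-addChord n g d g≤ D = begin
  lrPairs (suc n) (addChord g d)                                            ≡⟨ lrPairs-descents (suc n) (addChord g d) (balanced-addChord n g d g≤ D B) ⟩
  descents (startWord (suc n) (addChord g d))                               ≡⟨ cong descents (startWord-addChord n g d g≤) ⟩
  descents (true ∷ insertAt g false (startWord n d))                        ≡⟨ descents-insertAt true (startWord n d) g ⟩
  𝟙 (descentRises true (startWord n d) g) + descents (true ∷ startWord n d) ≡⟨ cong (𝟙 (descentRises true (startWord n d) g) +_) lr ⟨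
  𝟙 (descentRises true (startWord n d) g) + lrPairs n d                     ∎
  where
  open ≡-Reasoning
  B = balanced n d D
  lr : lrPairs n d ≡ descents (true ∷ startWord n d)
  lr = trans (lrPairs-descents n d B) (sym (descents-true (startWord n d) (Balanced.first B)))

non-raising-lr : ∀ n d → IsDiagram n d → count (not ∘ descentRises true (startWord n d)) (upTo (suc (2 * n))) ≡ n + lrPairs n d
non-raising-lr n d D = +-cancelʳ-≡ (suc n) _ _ (begin
  Z + suc n                                    ≡⟨ cong (λ L → count (not ∘ descentRises true t) (upTo (suc L)) + suc n) length-t ⟨
  Z′ + suc n                                   ≡⟨ cong (λ c → Z′ + suc c) (Balanced.starts B) ⟨
  Z′ + trues (true ∷ t)                        ≡⟨ non-rising-descents true t ⟩
  suc (length t) + descents (true ∷ t)         ≡⟨ cong₂ (λ L c → suc L + c) length-t (trans (descents-true t (Balanced.first B)) (sym (lrPairs-descents n d B))) ⟩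
  suc (2 * n) + lrPairs n d                    ≡⟨ rearrange n (lrPairs n d) ⟩
  (n + lrPairs n d) + suc n                    ∎)
  where
  open ≡-Reasoning
  B = balanced n d D
  t = startWord n d
  Z  = count (not ∘ descentRises true t) (upTo (suc (2 * n)))
  Z′ = count (not ∘ descentRises true t) (upTo (suc (length t)))
  length-t : length t ≡ 2 * n
  length-t = trans (length-map (isStartpoint d) (interval 1 (2 * n))) (length-interval 1 (2 * n))
  rearrange : ∀ n l → suc (2 * n) + l ≡ (n + l) + suc n
  rearrange = solve-∀

chordInsertion : ∀ n → Insertion (chordDiagrams n) (chordDiagrams (suc n)) (2 * n)
chordInsertion n = record
  { unique         = unique-chordDiagrams n
  ; unique'        = unique-chordDiagrams (suc n)
  ; insert         = growDiagram
  ; extract        = shrinkDiagram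
  ; insert∈        = λ d∈ g≤ → ∈-chordDiagrams⁺ (suc n) (grow-isDiagram n _ _ (∈-chordDiagrams⁻ n d∈) g≤)
  ; extract∈       = λ d∈ → let D = ∈-chordDiagrams⁻ (suc n) d∈ in ∈-chordDiagrams⁺ n (ShrinkDiagram.isDiagram D) , ShrinkDiagram.gap≤′ D
  ; extract∘insert = λ {d} {g} _ _ → shrink-grow-diagram g d
  ; insert∘extract = λ d∈ → ShrinkDiagram.grow-shrink (∈-chordDiagrams⁻ (suc n) d∈)
  }

chordCount-recurrence : ∀ n k → chordCount (suc n) k
  ≡ (n + k) * chordCount n k + (suc n ∸ pred k) * count (λ d → suc (lrPairs n d) ≡ᵇ k) (chordDiagrams n)
chordCount-recurrence n k = begin
  chordCount (suc n) k
    ≡⟨ length-filterᵇ _ (chordDiagrams (suc n)) ⟩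
  count (λ d → lrPairs (suc n) d ≡ᵇ k) (chordDiagrams (suc n))
    ≡⟨ insertion-recurrence (chordInsertion n) (lrPairs n) (lrPairs (suc n)) (descentRises true ∘ startWord n) (n +_)
         (λ d∈ g≤ → lrPairs-addChord n _ _ g≤ (∈-chordDiagrams⁻ n d∈)) (λ d∈ → non-raising-lr n _ (∈-chordDiagrams⁻ n d∈)) k ⟩
  (n + k) * count (λ d → lrPairs n d ≡ᵇ k) (chordDiagrams n) + (suc (2 * n) ∸ (n + pred k)) * count (λ d → suc (lrPairs n d) ≡ᵇ k) (chordDiagrams n)
    ≡⟨ cong₂ (λ c e → (n + k) * c + e * count (λ d → suc (lrPairs n d) ≡ᵇ k) (chordDiagrams n)) (length-filterᵇ _ (chordDiagrams n)) raising ⟨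
  (n + k) * chordCount n k + (suc n ∸ pred k) * count (λ d → suc (lrPairs n d) ≡ᵇ k) (chordDiagrams n) ∎
  where
  open ≡-Reasoning
  raising : suc n ∸ pred k ≡ suc (2 * n) ∸ (n + pred k)
  raising = trans (sym ([m+n]∸[m+o]≡n∸o n (suc n) (pred k))) (cong (_∸ (n + pred k)) (double n))
    where double : ∀ n → n + suc n ≡ suc (2 * n)
          double = solve-∀

E-zero : ∀ n → E (suc n) 0 ≡ E n 0
E-zero n = begin
  E (suc n) 0                                                              ≡⟨ E-recurrence n 0 ⟩
  1 * E n 0 + (2 * n) * count (λ _ → false) (stirlingPerms n)              ≡⟨ cong (λ c → 1 * E n 0 + 2 * n * c) (count-false (stirlingPerms n)) ⟩
  1 * E n 0 + (2 * n) * 0                                                  ≡⟨ simplify (E n 0) (2 * n) ⟩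
  E n 0                                                                    ∎
  where
  open ≡-Reasoning
  simplify : ∀ e c → 1 * e + c * 0 ≡ e
  simplify = solve-∀

E-suc : ∀ n j → E (suc n) (suc j) ≡ (2 + j) * E n (suc j) + (2 * n ∸ j) * E n j
E-suc n j = trans (E-recurrence n (suc j)) (cong (λ c → (2 + j) * E n (suc j) + (2 * n ∸ j) * c) (sym (length-filterᵇ _ (stirlingPerms n))))

chordCount-zero : ∀ n → chordCount (suc n) 0 ≡ n * chordCount n 0
chordCount-zero n = begin
  chordCount (suc n) 0                                                     ≡⟨ chordCount-recurrence n 0 ⟩
  (n + 0) * chordCount n 0 + suc n * count (λ _ → false) (chordDiagrams n) ≡⟨ cong (λ c → (n + 0) * chordCount n 0 + suc n * c) (count-false (chordDiagrams n)) ⟩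
  (n + 0) * chordCount n 0 + suc n * 0                                     ≡⟨ simplify n (chordCount n 0) ⟩
  n * chordCount n 0                                                       ∎
  where
  open ≡-Reasoning
  simplify : ∀ n c → (n + 0) * c + suc n * 0 ≡ n * c
  simplify = solve-∀

chordCount-suc : ∀ n k → chordCount (suc n) (suc k) ≡ (n + suc k) * chordCount n (suc k) + (suc n ∸ k) * chordCount n k
chordCount-suc n k = trans (chordCount-recurrence n (suc k)) (cong (λ c → (n + suc k) * chordCount n (suc k) + (suc n ∸ k) * c) (sym (length-filterᵇ _ (chordDiagrams n))))

E-vanishes : ∀ n j → 1 ≤ n → n ≤ j → E n j ≡ 0
E-vanishes (suc zero)    (suc j) _ _         = refl
E-vanishes (suc (suc m)) (suc j) _ (s≤s m<j) = begin
  E (suc (suc m)) (suc j)                                     ≡⟨ E-suc (suc m) j ⟩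
  (2 + j) * E (suc m) (suc j) + (2 * suc m ∸ j) * E (suc m) j ≡⟨ cong₂ (λ a b → (2 + j) * a + (2 * suc m ∸ j) * b)
                                                                        (E-vanishes (suc m) (suc j) (s≤s z≤n) (m≤n⇒m≤1+n m<j)) (E-vanishes (suc m) j (s≤s z≤n) m<j) ⟩
  (2 + j) * 0 + (2 * suc m ∸ j) * 0                           ≡⟨ cong₂ _+_ (*-zeroʳ (2 + j)) (*-zeroʳ (2 * suc m ∸ j)) ⟩
  0                                                           ∎
  where open ≡-Reasoning

chordCount-vanishes-0 : ∀ n → 1 ≤ n → chordCount n 0 ≡ 0
chordCount-vanishes-0 (suc zero)    _ = refl
chordCount-vanishes-0 (suc (suc m)) _ = trans (chordCount-zero (suc m)) (trans (cong (suc m *_) (chordCount-vanishes-0 (suc m) (s≤s z≤n))) (*-zeroʳ (suc m)))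

chordCount-vanishes : ∀ n k → n < k → chordCount n k ≡ 0
chordCount-vanishes zero    (suc k) _         = refl
chordCount-vanishes (suc m) (suc k) (s≤s m<k) = trans (chordCount-suc m k) (cong₂ _+_
  (trans (cong ((m + suc k) *_) (chordCount-vanishes m (suc k) (m≤n⇒m≤1+n m<k))) (*-zeroʳ (m + suc k)))
  (trans (cong ((suc m ∸ k) *_) (chordCount-vanishes m k m<k)) (*-zeroʳ (suc m ∸ k))))

T-inside : ∀ n k → 1 ≤ k → k ≤ n → T n k ≡ E n (n ∸ k)
T-inside n (suc k) _ k<n rewrite ≤⇒≤ᵇ′ k<n = refl

T-outside : ∀ n k → n < k → T n k ≡ 0
T-outside n (suc k) n<k rewrite ≰⇒≤ᵇ-false (suc k) n (<⇒≱ n<k) = refl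

-- T(m, k) = E(m, m - k) also for k = 0 when m - k = j + 1 ≥ 1, as then both vanish.
T-as-E : ∀ k j → T (k + suc j) k ≡ E (k + suc j) (suc j)
T-as-E zero     j = sym (E-vanishes (suc j) (suc j) (s≤s z≤n) ≤-refl)
T-as-E (suc k′) j = trans (T-inside (suc k′ + suc j) (suc k′) (s≤s z≤n) (m≤m+n (suc k′) (suc j))) (cong (E (suc k′ + suc j)) (m+n∸m≡n (suc k′) (suc j)))

T-recurrence-below : ∀ k j → let m = k + suc j in
  T (suc m) (suc k) ≡ (m ∸ k + 1) * T m k + (m + suc k) * T m (suc k)
T-recurrence-below k j = begin
  T (suc m) (suc k)                                   ≡⟨ T-inside (suc m) (suc k) (s≤s z≤n) (s≤s (m≤m+n k (suc j))) ⟩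
  E (suc m) (m ∸ k)                                   ≡⟨ cong (E (suc m)) m∸k ⟩
  E (suc m) (suc j)                                   ≡⟨ E-suc m j ⟩
  (2 + j) * E m (suc j) + (2 * m ∸ j) * E m j         ≡⟨ cong₂ _+_ (cong₂ _*_ (sym coefficient₁) (sym T-k)) (cong₂ _*_ coefficient₂ (sym T-k+1)) ⟩
  (m ∸ k + 1) * T m k + (m + suc k) * T m (suc k)     ∎
  where
  open ≡-Reasoning
  m = k + suc j
  m∸k : m ∸ k ≡ suc j
  m∸k = m+n∸m≡n k (suc j)
  coefficient₁ : m ∸ k + 1 ≡ 2 + j
  coefficient₁ = trans (cong (_+ 1) m∸k) (+-comm (suc j) 1)
  coefficient₂ : 2 * m ∸ j ≡ m + suc k
  coefficient₂ = trans (cong (_∸ j) (split k j)) (m+n∸n≡m (m + suc k) j)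
    where split : ∀ k j → 2 * (k + suc j) ≡ (k + suc j + suc k) + j
          split = solve-∀
  T-k : T m k ≡ E m (suc j)
  T-k = T-as-E k j
  T-k+1 : T m (suc k) ≡ E m j
  T-k+1 = trans (T-inside m (suc k) (s≤s z≤n) (subst (suc k ≤_) (sym (+-suc k j)) (s≤s (m≤m+n k j))))
                (cong (E m) (trans (cong (_∸ suc k) (+-suc k j)) (m+n∸m≡n (suc k) j)))

T-recurrence-diagonal : ∀ m → 1 ≤ m → T (suc m) (suc m) ≡ (m ∸ m + 1) * T m m + (m + suc m) * T m (suc m)
T-recurrence-diagonal m 1≤m = begin
  T (suc m) (suc m)                                   ≡⟨ T-inside (suc m) (suc m) (s≤s z≤n) ≤-refl ⟩
  E (suc m) (m ∸ m)                                   ≡⟨ cong (E (suc m)) (n∸n≡0 m) ⟩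
  E (suc m) 0                                         ≡⟨ E-zero m ⟩
  E m 0                                               ≡⟨ cong (E m) (n∸n≡0 m) ⟨
  E m (m ∸ m)                                         ≡⟨ T-inside m m 1≤m ≤-refl ⟨
  T m m                                               ≡⟨ simplify (T m m) (m + suc m) ⟨
  1 * T m m + (m + suc m) * 0                         ≡⟨ cong₂ (λ a b → (a + 1) * T m m + (m + suc m) * b) (n∸n≡0 m) (T-outside m (suc m) ≤-refl) ⟨
  (m ∸ m + 1) * T m m + (m + suc m) * T m (suc m)     ∎
  where
  open ≡-Reasoning
  simplify : ∀ t c → 1 * t + c * 0 ≡ t
  simplify = solve-∀

T-recurrence : ∀ m k → 1 ≤ m → k ≤ m → T (suc m) (suc k) ≡ (m ∸ k + 1) * T m k + (m + suc k) * T m (suc k)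
T-recurrence m k 1≤m k≤m with m≤n⇒m<n∨m≡n k≤m
... | inj₂ refl = T-recurrence-diagonal m 1≤m
... | inj₁ k<m  = subst (λ m → T (suc m) (suc k) ≡ (m ∸ k + 1) * T m k + (m + suc k) * T m (suc k))
                        (trans (+-suc k (m ∸ suc k)) (m+[n∸m]≡n k<m)) (T-recurrence-below k (m ∸ suc k))

T-first : (n : ℕ) → 1 ≤ n → T n 1 ≡ n !
T-first (suc zero)    _ = refl
T-first (suc (suc m)) _ = begin
  T (suc (suc m)) 1                                    ≡⟨ T-recurrence (suc m) 0 (s≤s z≤n) z≤n ⟩
  (suc m ∸ 0 + 1) * 0 + (suc m + 1) * T (suc m) 1      ≡⟨ cong (λ t → (suc m ∸ 0 + 1) * 0 + (suc m + 1) * t) (T-first (suc m) (s≤s z≤n)) ⟩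
  (suc m ∸ 0 + 1) * 0 + (suc m + 1) * suc m !          ≡⟨ simplify (suc m ∸ 0 + 1) (suc m) (suc m !) ⟩
  suc (suc m) * suc m !                                ∎
  where
  open ≡-Reasoning
  simplify : ∀ c m f → c * 0 + (m + 1) * f ≡ (1 + m) * f
  simplify = solve-∀

T-recurrence-statement : (n k : ℕ) → 2 ≤ n → 1 ≤ k → k ≤ n → T n k ≡ (n ∸ k + 1) * T (n ∸ 1) (k ∸ 1) + (n ∸ 1 + k) * T (n ∸ 1) k
T-recurrence-statement (suc (suc m)) (suc k) (s≤s (s≤s z≤n)) _ (s≤s k≤) = T-recurrence (suc m) k (s≤s z≤n) k≤

-- T and chordCount agree, as they satisfy the same recurrence and vanishing.
T≡chordCount-step : ∀ m → (∀ k → T (suc m) k ≡ chordCount (suc m) k) → ∀ k → T (suc (suc m)) k ≡ chordCount (suc (suc m)) k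
T≡chordCount-step m IH zero = sym (chordCount-vanishes-0 (suc (suc m)) (s≤s z≤n))
T≡chordCount-step m IH (suc k) with k ≤? suc m
... | no  k≰ = trans (T-outside (suc (suc m)) (suc k) (s≤s (≰⇒> k≰))) (sym (chordCount-vanishes (suc (suc m)) (suc k) (s≤s (≰⇒> k≰))))
... | yes k≤ = begin
  T (suc (suc m)) (suc k)                                                        ≡⟨ T-recurrence (suc m) k (s≤s z≤n) k≤ ⟩
  (suc m ∸ k + 1) * T (suc m) k + (suc m + suc k) * T (suc m) (suc k)            ≡⟨ cong₂ (λ a b → (suc m ∸ k + 1) * a + (suc m + suc k) * b) (IH k) (IH (suc k)) ⟩
  (suc m ∸ k + 1) * chordCount (suc m) k + (suc m + suc k) * chordCount (suc m) (suc k)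
    ≡⟨ +-comm _ ((suc m + suc k) * chordCount (suc m) (suc k)) ⟩
  (suc m + suc k) * chordCount (suc m) (suc k) + (suc m ∸ k + 1) * chordCount (suc m) k
    ≡⟨ cong (λ c → (suc m + suc k) * chordCount (suc m) (suc k) + c * chordCount (suc m) k) coefficient ⟩
  (suc m + suc k) * chordCount (suc m) (suc k) + (suc (suc m) ∸ k) * chordCount (suc m) k ≡⟨ chordCount-suc (suc m) k ⟨
  chordCount (suc (suc m)) (suc k)                                               ∎
  where
  open ≡-Reasoning
  coefficient : suc m ∸ k + 1 ≡ suc (suc m) ∸ k
  coefficient = trans (+-comm (suc m ∸ k) 1) (sym (+-∸-assoc 1 k≤))

T≡chordCount : ∀ n → 1 ≤ n → ∀ k → T n k ≡ chordCount n k
T≡chordCount (suc zero)    _ zero          = refl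
T≡chordCount (suc zero)    _ (suc zero)    = refl
T≡chordCount (suc zero)    _ (suc (suc k)) = refl
T≡chordCount (suc (suc m)) _               = T≡chordCount-step m (T≡chordCount (suc m) (s≤s z≤n))

mainTheorem3 : ((n : ℕ) → 1 ≤ n → T n 1 ≡ n !)
    × ((n k : ℕ) → 2 ≤ n → 1 ≤ k → k ≤ n → T n k ≡ (n ∸ k + 1) * T (n ∸ 1) (k ∸ 1) + (n ∸ 1 + k) * T (n ∸ 1) k)
    × ((n k : ℕ) → 1 ≤ n → 1 ≤ k → k ≤ n → T n k ≡ chordCount n k)
mainTheorem3 = T-first , T-recurrence-statement , λ n k 1≤n _ _ → T≡chordCount n 1≤n k
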